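{- Let $n\ge1$ and let $\lambda=(\lambda_1,\dots,\lambda_n)$ be a partition with at most $n$ nonzero parts, padded with zeros to length $n$. Set $A_{ij}=\lambda_i-\lambda_j+j-i$ for $1\le i<j\le n$. Then $$F^{(n)}\big((A_{ij})\,\big|\,(0,-1,\dots,-(n-1))^{T}\,\big|\,(1,\dots,1)^{T}\,\big|\,(1,\dots,1)^{T}\big)=\frac{1}{|\mathrm{SST}(\lambda,n)|}.$$
   Context: $\mathrm{SST}(\lambda,n)$ is the set of semistandard tableaux of shape $\lambda$ with entries in $[n]$ (rows weakly increasing, columns strictly increasing). Holman's hypergeometric function (with one numerator and one denominator parameter per index) is $$F^{(n)}\big((A_{ij})_{1\le i<j\le n}\,\big|\,(a_i)\,\big|\,(b_i)\,\big|\,(z_i)\big)=\sum_{k_1,\dots,k_n\ge0}\Big(\prod_{1\le i<j\le n}\frac{A_{ij}+k_i-k_j}{A_{ij}}\Big)\prod_{i=1}^n\frac{(a_i)_{k_i}}{(b_i)_{k_i}}z_i^{k_i},$$ with $(a)_m=a(a+1)\cdots(a+m-1)$, $(a)_0=1$. With $a_i=-(i-1)$ the sum is finite. -}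

module Defs where

open import Data.Nat as ℕ using (ℕ; zero; suc)
open import Data.Fin as Fin using (Fin; toℕ)
open import Data.Integer as ℤ using (ℤ)
open import Data.Rational as ℚ using (ℚ; 0ℚ; 1ℚ; _+_; _*_; _÷_; ≢-nonZero)
open import Data.Product using (Σ; ∃; _×_; proj₁)
open import Relation.Nullary using (yes; no)
open import Relation.Binary.PropositionalEquality using (_≡_)

-- Total division on ℚ: the usual quotient whenever the denominator is
-- nonzero (returns 0 otherwise; this case never arises in theorem3p12,
-- where all A_ij ≥ 1 and all (b_i)_k = k! ≠ 0).
_÷'_ : ℚ → ℚ → ℚ
p ÷' q with q ℚ.≟ 0ℚ
... | yes _ = 0ℚ
... | no q≢0 = _÷_ p q {{≢-nonZero q≢0}}

fromℕℚ : ℕ → ℚ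
fromℕℚ m = ℤ.+ m ℚ./ 1

powℚ : ℚ → ℕ → ℚ
powℚ x zero = 1ℚ
powℚ x (suc m) = powℚ x m * x

poch : ℚ → ℕ → ℚ
poch a zero = 1ℚ
poch a (suc m) = poch a m * (a + fromℕℚ m)

sumTo : ℕ → (ℕ → ℚ) → ℚ
sumTo zero f = f 0
sumTo (suc N) f = sumTo N f + f (suc N)

prodFin : (n : ℕ) → (Fin n → ℚ) → ℚ
prodFin zero g = 1ℚ
prodFin (suc n) g = g Fin.zero * prodFin n (λ i → g (Fin.suc i))

boxSum : (n : ℕ) → ℕ → ((Fin n → ℕ) → ℚ) → ℚ
boxSum zero N f = f (λ ())
boxSum (suc n) N f =
  sumTo N (λ k → boxSum n N (λ ks → f (λ { Fin.zero → k ; (Fin.suc i) → ks i })))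

-- Summand of Holman's F^(n); indices 1..n are represented by Fin n (0-based).
holmanTerm : (n : ℕ) → (A : Fin n → Fin n → ℚ) → (a b z : Fin n → ℚ)
           → (Fin n → ℕ) → ℚ
holmanTerm n A a b z k =
  prodFin n (λ i → prodFin n (λ j → pairFactor i j))
  * prodFin n (λ i → (poch (a i) (k i) ÷' poch (b i) (k i)) * (powℚ (z i) (k i)))
  where
  pairFactor : Fin n → Fin n → ℚ
  pairFactor i j with toℕ i ℕ.<? toℕ j
  ... | yes _ = (A i j + fromℕℚ (k i) ℚ.- fromℕℚ (k j)) ÷' A i j
  ... | no _ = 1ℚ

holmanPartial : (n : ℕ) → (A : Fin n → Fin n → ℚ) → (a b z : Fin n → ℚ) → ℕ → ℚ
holmanPartial n A a b z N = boxSum n N (holmanTerm n A a b z)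

-- The series F^(n) sums to v: its box partial sums are eventually equal to v
-- (the series considered here has only finitely many nonzero terms).
HolmanSumsTo : (n : ℕ) → (A : Fin n → Fin n → ℚ) → (a b z : Fin n → ℚ) → ℚ → Set
HolmanSumsTo n A a b z v =
  ∃ λ N₀ → ∀ N → N₀ ℕ.≤ N → holmanPartial n A a b z N ≡ v

IsPartition : (n : ℕ) → (Fin n → ℕ) → Set
IsPartition n μ = ∀ (i j : Fin n) → i Fin.≤ j → μ j ℕ.≤ μ i

-- A filling of the Young diagram of shape μ with entries in [n] (= Fin n):
-- row i has μ i cells.
Filling : (n : ℕ) → (Fin n → ℕ) → Set
Filling n μ = (i : Fin n) → Fin (μ i) → Fin n

IsSST : (n : ℕ) → (μ : Fin n → ℕ) → Filling n μ → Set
IsSST n μ T =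
  (∀ (i : Fin n) (j j' : Fin (μ i)) → j Fin.≤ j' → T i j Fin.≤ T i j')
  × (∀ (i i' : Fin n) → i Fin.< i' → (j : Fin (μ i)) (j' : Fin (μ i'))
       → toℕ j ≡ toℕ j' → T i j Fin.< T i' j')

SST : (n : ℕ) → (Fin n → ℕ) → Set
SST n μ = Σ (Filling n μ) (IsSST n μ)

_≈SST_ : {n : ℕ} {μ : Fin n → ℕ} → SST n μ → SST n μ → Set
_≈SST_ {n} {μ} T T' = ∀ (i : Fin n) (j : Fin (μ i)) → proj₁ T i j ≡ proj₁ T' i j

-- |SST(μ,n)| = c : an enumeration e of SST(μ,n) by Fin c that is surjective
-- and injective (up to equality of entries).
HasCardSST : (n : ℕ) → (Fin n → ℕ) → ℕ → Set
HasCardSST n μ c =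
  Σ (Fin c → SST n μ) λ e →
    (∀ (T : SST n μ) → ∃ λ k → e k ≈SST T)
    × (∀ (k k' : Fin c) → e k ≈SST e k' → k ≡ k')

Aμ : (n : ℕ) → (Fin n → ℕ) → Fin n → Fin n → ℚ
Aμ n μ i j = fromℕℚ (μ i) ℚ.- fromℕℚ (μ j) ℚ.+ fromℕℚ (toℕ j) ℚ.- fromℕℚ (toℕ i)

-- a_i = -(i-1) in 1-based indexing, i.e. -(toℕ i) 0-based.
aSeq : (n : ℕ) → Fin n → ℚ
aSeq n i = ℚ.- fromℕℚ (toℕ i)

ones : (n : ℕ) → Fin n → ℚ
ones n i = 1ℚ

{-# OPTIONS --safe #-}
module Submission where

-- Write ℓᵢ = μᵢ + (n − 1 − i), so that A_ij = ℓᵢ − ℓⱼ, and Δ(y) = ∏_{i<j} (yᵢ − yⱼ).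
-- Since (−i)_k / k! = (−1)^k C(i,k), the Holman summand at k is
-- Δ(ℓ + k) / Δ(ℓ) · ∏ᵢ (−1)^{kᵢ} C(i,kᵢ). The Vandermonde identity in the binomial basis,
-- sf(n) det[C(yᵢ, j)] = ±Δ(y) with sf(n) = ∏_{j<n} j!, turns Δ(ℓ + k) into a determinant,
-- and by multilinearity in the rows the sum over k is taken row by row:
-- ∑ₜ (−1)^t C(i,t) C(ℓᵢ + t, j) = (−1)^i C(ℓᵢ, j − i), a triangular matrix with diagonal ±1.
-- So the series sums to sf(n)/Δ(ℓ).
-- On the other side, deleting the entries n of a tableau leaves a tableau with entries in
-- [n − 1] whose shape interlaces μ, so |SST(μ,n)| = ∑_ν |SST(ν,n−1)| over interlacing ν.
-- Differencing consecutive rows and the hockey-stick identity show that ±det[C(ℓᵢ, j)]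
-- satisfies the same recursion; hence |SST(μ,n)| = Δ(ℓ)/sf(n).

open import Defs
open import Data.Nat using (ℕ; _≤_)
open import Data.Fin using (Fin)
open import Data.Product using (Σ; _×_)
open import Data.Rational using (1ℚ)

open import Data.Nat as ℕ using (zero; suc)
import Data.Nat.Properties as NP
import Data.Nat.Coprimality as Coprime
open import Data.Fin as F using (toℕ)
import Data.Fin.Properties as FP
open import Data.Rational as ℚ using (ℚ; 0ℚ; _+_; _*_; -_; _-_; mkℚ)
import Data.Rational.Properties as QP
open import Data.Integer as ℤ using (ℤ)
import Data.Integer.Properties as ZP
open import Data.Product using (∃; _,_; proj₁; proj₂)
open import Data.Sum using (_⊎_; inj₁; inj₂)
open import Data.Unit using (⊤; tt)
open import Data.Empty using (⊥-elim)
open import Function using (_∘_)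
open import Data.Vec.Functional using (updateAt) renaming (_∷_ to _V∷_)
open import Data.Vec.Functional.Properties using (updateAt-updates; updateAt-minimal)
open import Relation.Nullary using (¬_; yes; no; Dec)
open import Relation.Binary.PropositionalEquality
open import Relation.Binary.Structures using (IsEquivalence)
open import Algebra.Bundles using (Ring)
open import Algebra.Properties.Semiring.Sum (Ring.semiring QP.+-*-ring)
  using (sum; sum-cong-≗; sum-remove; ∑-distrib-+; *-distribˡ-sum)
open import Algebra.Properties.Monoid.Sum NP.+-0-monoid using () renaming (sum to sumℕ)
open import Data.Rational.Solver using (module +-*-Solver)
open +-*-Solver

-- Rational arithmetic

fromℕℚ≡mkℚ : ∀ m → fromℕℚ m ≡ mkℚ (ℤ.+ m) 0 (Coprime.sym (Coprime.1-coprimeTo m))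
fromℕℚ≡mkℚ m = QP.normalize-coprime (Coprime.sym (Coprime.1-coprimeTo m))

fromℕℚ-+ : ∀ a b → fromℕℚ (a ℕ.+ b) ≡ fromℕℚ a + fromℕℚ b
fromℕℚ-+ a b = sym (begin
  fromℕℚ a + fromℕℚ b
    ≡⟨ cong₂ _+_ (fromℕℚ≡mkℚ a) (fromℕℚ≡mkℚ b) ⟩
  (ℤ.+ a ℤ.* ℤ.+ 1 ℤ.+ ℤ.+ b ℤ.* ℤ.+ 1) ℚ./ 1
    ≡⟨ QP./-cong (cong₂ ℤ._+_ (ZP.*-identityʳ (ℤ.+ a)) (ZP.*-identityʳ (ℤ.+ b))) refl ⟩
  fromℕℚ (a ℕ.+ b) ∎)
  where open ≡-Reasoning

fromℕℚ-suc : ∀ k → fromℕℚ (suc k) ≡ 1ℚ + fromℕℚ k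
fromℕℚ-suc = fromℕℚ-+ 1

fromℕℚ-injective : ∀ a b → fromℕℚ a ≡ fromℕℚ b → a ≡ b
fromℕℚ-injective a b e = cong ℤ.∣_∣ (begin
  ℤ.+ a                          ≡⟨ cong ℚ.numerator (fromℕℚ≡mkℚ a) ⟨
  ℚ.numerator (fromℕℚ a)         ≡⟨ cong ℚ.numerator e ⟩
  ℚ.numerator (fromℕℚ b)         ≡⟨ cong ℚ.numerator (fromℕℚ≡mkℚ b) ⟩
  ℤ.+ b                          ∎)
  where open ≡-Reasoning

fromℕℚ-suc≢0 : ∀ k → fromℕℚ (suc k) ≢ 0ℚ
fromℕℚ-suc≢0 k e = NP.1+n≢0 (fromℕℚ-injective (suc k) 0 e)

fromℕℚ-difference≢0 : ∀ {a b} → a ≢ b → fromℕℚ a - fromℕℚ b ≢ 0ℚ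
fromℕℚ-difference≢0 {a} {b} a≢b e = a≢b (fromℕℚ-injective a b (begin
  fromℕℚ a                        ≡⟨ solve 2 (λ x y → x := (x :- y) :+ y) refl (fromℕℚ a) (fromℕℚ b) ⟩
  (fromℕℚ a - fromℕℚ b) + fromℕℚ b ≡⟨ cong (_+ fromℕℚ b) e ⟩
  0ℚ + fromℕℚ b                   ≡⟨ QP.+-identityˡ _ ⟩
  fromℕℚ b                        ∎))
  where open ≡-Reasoning

sign : ℕ → ℚ
sign zero    = 1ℚ
sign (suc k) = - sign k

sign²≡1 : ∀ a → sign a * sign a ≡ 1ℚ
sign²≡1 zero    = refl
sign²≡1 (suc a) = trans (solve 1 (λ x → (:- x) :* (:- x) := x :* x) refl (sign a)) (sign²≡1 a)

*-≢0 : ∀ {p q} → p ≢ 0ℚ → q ≢ 0ℚ → p * q ≢ 0ℚ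
*-≢0 {p} {q} p≢0 q≢0 pq≡0 = q≢0 (begin
  q              ≡⟨ QP.*-identityˡ q ⟨
  1ℚ * q         ≡⟨ cong (_* q) (QP.*-inverseˡ p {{ℚ.≢-nonZero p≢0}}) ⟨
  (p⁻¹ * p) * q  ≡⟨ QP.*-assoc p⁻¹ p q ⟩
  p⁻¹ * (p * q)  ≡⟨ cong (p⁻¹ *_) pq≡0 ⟩
  p⁻¹ * 0ℚ       ≡⟨ QP.*-zeroʳ p⁻¹ ⟩
  0ℚ             ∎)
  where
  open ≡-Reasoning
  p⁻¹ = (ℚ.1/ p) {{ℚ.≢-nonZero p≢0}}

*-cancelʳ : ∀ {a b q} → q ≢ 0ℚ → a * q ≡ b * q → a ≡ b
*-cancelʳ {a} {b} {q} q≢0 e = begin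
  a              ≡⟨ trans (cong (a *_) q*q⁻¹≡1) (QP.*-identityʳ a) ⟨
  a * (q * q⁻¹)  ≡⟨ QP.*-assoc a q q⁻¹ ⟨
  (a * q) * q⁻¹  ≡⟨ cong (_* q⁻¹) e ⟩
  (b * q) * q⁻¹  ≡⟨ QP.*-assoc b q q⁻¹ ⟩
  b * (q * q⁻¹)  ≡⟨ trans (cong (b *_) q*q⁻¹≡1) (QP.*-identityʳ b) ⟩
  b              ∎
  where
  open ≡-Reasoning
  q⁻¹ = (ℚ.1/ q) {{ℚ.≢-nonZero q≢0}}
  q*q⁻¹≡1 : q * q⁻¹ ≡ 1ℚ
  q*q⁻¹≡1 = QP.*-inverseʳ q {{ℚ.≢-nonZero q≢0}}

÷'-*-cancel : ∀ p {q} → q ≢ 0ℚ → (p ÷' q) * q ≡ p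
÷'-*-cancel p {q} q≢0 with q ℚ.≟ 0ℚ
... | yes q≡0 = ⊥-elim (q≢0 q≡0)
... | no q≢0′ = begin
  (p * q⁻¹) * q  ≡⟨ QP.*-assoc p q⁻¹ q ⟩
  p * (q⁻¹ * q)  ≡⟨ cong (p *_) (QP.*-inverseˡ q {{ℚ.≢-nonZero q≢0′}}) ⟩
  p * 1ℚ         ≡⟨ QP.*-identityʳ p ⟩
  p              ∎
  where
  open ≡-Reasoning
  q⁻¹ = (ℚ.1/ q) {{ℚ.≢-nonZero q≢0′}}

÷'-unique : ∀ {p q r} → q ≢ 0ℚ → r * q ≡ p → p ÷' q ≡ r
÷'-unique {p} q≢0 r*q≡p = *-cancelʳ q≢0 (trans (÷'-*-cancel p q≢0) (sym r*q≡p))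

1÷'1≡1 : 1ℚ ÷' 1ℚ ≡ 1ℚ
1÷'1≡1 = ÷'-unique QP.1≢0 refl

÷'≡*1÷' : ∀ a {b} → b ≢ 0ℚ → a ÷' b ≡ a * (1ℚ ÷' b)
÷'≡*1÷' a {b} b≢0 = ÷'-unique b≢0 (begin
  (a * (1ℚ ÷' b)) * b  ≡⟨ QP.*-assoc a (1ℚ ÷' b) b ⟩
  a * ((1ℚ ÷' b) * b)  ≡⟨ cong (a *_) (÷'-*-cancel 1ℚ b≢0) ⟩
  a * 1ℚ               ≡⟨ QP.*-identityʳ a ⟩
  a                    ∎)
  where open ≡-Reasoning

÷'-*-÷' : ∀ a {b} c {d} → b ≢ 0ℚ → d ≢ 0ℚ → (a ÷' b) * (c ÷' d) ≡ (a * c) ÷' (b * d)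
÷'-*-÷' a {b} c {d} b≢0 d≢0 = sym (÷'-unique (*-≢0 b≢0 d≢0) (begin
  ((a ÷' b) * (c ÷' d)) * (b * d)
    ≡⟨ solve 4 (λ x y b d → (x :* y) :* (b :* d) := (x :* b) :* (y :* d)) refl (a ÷' b) (c ÷' d) b d ⟩
  ((a ÷' b) * b) * ((c ÷' d) * d)
    ≡⟨ cong₂ _*_ (÷'-*-cancel a b≢0) (÷'-*-cancel c d≢0) ⟩
  a * c ∎))
  where open ≡-Reasoning

-- Finite sums and products

prodFin-cong : ∀ n {f g : Fin n → ℚ} → (∀ i → f i ≡ g i) → prodFin n f ≡ prodFin n g
prodFin-cong zero    f≗g = refl
prodFin-cong (suc n) f≗g = cong₂ _*_ (f≗g F.zero) (prodFin-cong n (f≗g ∘ F.suc))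

prodFin-removeAt : ∀ n p (f : Fin (suc n) → ℚ) → prodFin (suc n) f ≡ f p * prodFin n (f ∘ F.punchIn p)
prodFin-removeAt n       F.zero    f = refl
prodFin-removeAt (suc n) (F.suc p) f = begin
  f F.zero * prodFin (suc n) (f ∘ F.suc)
    ≡⟨ cong (f F.zero *_) (prodFin-removeAt n p (f ∘ F.suc)) ⟩
  f F.zero * (f (F.suc p) * prodFin n (f ∘ F.suc ∘ F.punchIn p))
    ≡⟨ solve 3 (λ x y z → x :* (y :* z) := y :* (x :* z)) refl (f F.zero) (f (F.suc p)) _ ⟩
  f (F.suc p) * (f F.zero * prodFin n (f ∘ F.suc ∘ F.punchIn p)) ∎
  where open ≡-Reasoning

prodFin-neg : ∀ n (f : Fin n → ℚ) → prodFin n (λ i → - f i) ≡ sign n * prodFin n f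
prodFin-neg zero    f = refl
prodFin-neg (suc n) f = trans (cong ((- f F.zero) *_) (prodFin-neg n (f ∘ F.suc)))
  (solve 3 (λ a s p → (:- a) :* (s :* p) := (:- s) :* (a :* p)) refl (f F.zero) (sign n) (prodFin n (f ∘ F.suc)))

prodFin-≢0 : ∀ n {f : Fin n → ℚ} → (∀ i → f i ≢ 0ℚ) → prodFin n f ≢ 0ℚ
prodFin-≢0 zero    f≢0 = QP.1≢0
prodFin-≢0 (suc n) f≢0 = *-≢0 (f≢0 F.zero) (prodFin-≢0 n (f≢0 ∘ F.suc))

prodFin-÷' : ∀ n (f g : Fin n → ℚ) → (∀ i → g i ≢ 0ℚ) → prodFin n (λ i → f i ÷' g i) ≡ prodFin n f ÷' prodFin n g
prodFin-÷' zero    f g g≢0 = sym 1÷'1≡1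
prodFin-÷' (suc n) f g g≢0 =
  trans (cong ((f F.zero ÷' g F.zero) *_) (prodFin-÷' n (f ∘ F.suc) (g ∘ F.suc) (g≢0 ∘ F.suc)))
        (÷'-*-÷' (f F.zero) _ (g≢0 F.zero) (prodFin-≢0 n (g≢0 ∘ F.suc)))

sum-zero : ∀ {n} (f : Fin n → ℚ) → (∀ i → f i ≡ 0ℚ) → sum f ≡ 0ℚ
sum-zero {zero}  f f≡0 = refl
sum-zero {suc n} f f≡0 = trans (cong₂ _+_ (f≡0 F.zero) (sum-zero (f ∘ F.suc) (f≡0 ∘ F.suc))) refl

sum-neg : ∀ {n} (f : Fin n → ℚ) → sum (λ i → - f i) ≡ - sum f
sum-neg {zero}  f = refl
sum-neg {suc n} f = trans (cong (- f F.zero +_) (sum-neg (f ∘ F.suc))) (sym (QP.neg-distrib-+ (f F.zero) _))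

sum-linear : ∀ {n} a b (f g : Fin n → ℚ) → sum (λ i → a * f i + b * g i) ≡ a * sum f + b * sum g
sum-linear a b f g = trans (∑-distrib-+ (λ i → a * f i) (λ i → b * g i))
  (sym (cong₂ _+_ (*-distribˡ-sum a f) (*-distribˡ-sum b g)))

sum-pairCancel : ∀ {n} (f : Fin n → ℚ) {p q} → p ≢ q → (∀ i → i ≢ p → i ≢ q → f i ≡ 0ℚ) →
                 f p + f q ≡ 0ℚ → sum f ≡ 0ℚ
sum-pairCancel {suc zero} f {F.zero} {F.zero} p≢q _ _ = ⊥-elim (p≢q refl)
sum-pairCancel {suc (suc n)} f {p} {q} p≢q f≡0 fp+fq≡0 = begin
  sum f                                                   ≡⟨ sum-remove {i = p} f ⟩
  f p + sum (f ∘ F.punchIn p)                             ≡⟨ cong (f p +_) (sum-remove {i = q′} (f ∘ F.punchIn p)) ⟩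
  f p + (f (F.punchIn p q′) + sum (f ∘ F.punchIn p ∘ F.punchIn q′))
    ≡⟨ cong₂ (λ x y → f p + (f x + y)) (FP.punchIn-punchOut p≢q) (sum-zero _ rest≡0) ⟩
  f p + (f q + 0ℚ)                                        ≡⟨ trans (cong (f p +_) (QP.+-identityʳ (f q))) fp+fq≡0 ⟩
  0ℚ                                                      ∎
  where
  open ≡-Reasoning
  q′ = F.punchOut p≢q
  rest≡0 : ∀ b → f (F.punchIn p (F.punchIn q′ b)) ≡ 0ℚ
  rest≡0 b = f≡0 _ (FP.punchInᵢ≢i p _) λ e → FP.punchInᵢ≢i q′ b
    (FP.punchIn-injective p _ _ (trans e (sym (FP.punchIn-punchOut p≢q))))

sumTo-cong : ∀ N {f g : ℕ → ℚ} → (∀ k → f k ≡ g k) → sumTo N f ≡ sumTo N g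
sumTo-cong zero    f≗g = f≗g 0
sumTo-cong (suc N) f≗g = cong₂ _+_ (sumTo-cong N f≗g) (f≗g (suc N))

sumTo-+ : ∀ N (f g : ℕ → ℚ) → sumTo N (λ k → f k + g k) ≡ sumTo N f + sumTo N g
sumTo-+ zero    f g = refl
sumTo-+ (suc N) f g = trans (cong (_+ (f (suc N) + g (suc N))) (sumTo-+ N f g))
  (solve 4 (λ a b c d → (a :+ b) :+ (c :+ d) := (a :+ c) :+ (b :+ d)) refl (sumTo N f) (sumTo N g) _ _)

sumTo-neg : ∀ N (f : ℕ → ℚ) → sumTo N (λ k → - f k) ≡ - sumTo N f
sumTo-neg zero    f = refl
sumTo-neg (suc N) f =
  trans (cong (_+ - f (suc N)) (sumTo-neg N f)) (sym (QP.neg-distrib-+ (sumTo N f) (f (suc N))))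

sumTo-difference : ∀ N (f g : ℕ → ℚ) → sumTo N (λ k → f k - g k) ≡ sumTo N f - sumTo N g
sumTo-difference N f g = trans (sumTo-+ N f (λ k → - g k)) (cong (sumTo N f +_) (sumTo-neg N g))

sumTo-suc : ∀ N (f : ℕ → ℚ) → sumTo (suc N) f ≡ f 0 + sumTo N (f ∘ suc)
sumTo-suc zero    f = refl
sumTo-suc (suc N) f = trans (cong (_+ f (suc (suc N))) (sumTo-suc N f)) (QP.+-assoc (f 0) _ _)

sumTo-vanishing : ∀ M N (f : ℕ → ℚ) → M ℕ.≤ N → (∀ k → M ℕ.< k → f k ≡ 0ℚ) → sumTo N f ≡ sumTo M f
sumTo-vanishing M N f M≤N f≡0 with NP.m≤n⇒∃[o]m+o≡n M≤N
... | d , refl = trans (cong (λ L → sumTo L f) (NP.+-comm M d)) (extend d)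
  where
  extend : ∀ d → sumTo (d ℕ.+ M) f ≡ sumTo M f
  extend zero    = refl
  extend (suc d) = trans (cong₂ _+_ (extend d) (f≡0 (suc (d ℕ.+ M)) (ℕ.s≤s (NP.m≤n+m M d))))
                         (QP.+-identityʳ _)

-- Binomial coefficients

binom : ℕ → ℕ → ℚ
binom x       zero    = 1ℚ
binom zero    (suc j) = 0ℚ
binom (suc x) (suc j) = binom x (suc j) + binom x j

binom-< : ∀ {i k} → i ℕ.< k → binom i k ≡ 0ℚ
binom-< {zero}  {suc k} _           = refl
binom-< {suc i} {suc k} (ℕ.s≤s i<k) = cong₂ _+_ (binom-< (NP.m<n⇒m<1+n i<k)) (binom-< i<k)

binom-1 : ∀ i → binom i 1 ≡ fromℕℚ i
binom-1 zero    = refl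
binom-1 (suc i) = trans (cong (_+ 1ℚ) (binom-1 i)) (trans (QP.+-comm (fromℕℚ i) 1ℚ) (sym (fromℕℚ-suc i)))

binom-hockeyStick : ∀ y d b → sumTo d (λ t → binom (y ℕ.+ t) b) ≡ binom (suc (y ℕ.+ d)) (suc b) - binom y (suc b)
binom-hockeyStick y zero b rewrite NP.+-identityʳ y =
  solve 2 (λ p q → p := (q :+ p) :- q) refl (binom y b) (binom y (suc b))
binom-hockeyStick y (suc d) b rewrite NP.+-suc y d =
  trans (cong (_+ binom (suc (y ℕ.+ d)) b) (binom-hockeyStick y d b))
        (solve 3 (λ P Q S → (P :- Q) :+ S := (P :+ S) :- Q) refl
           (binom (suc (y ℕ.+ d)) (suc b)) (binom y (suc b)) (binom (suc (y ℕ.+ d)) b))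

binom-absorption : ∀ i k → fromℕℚ (suc k) * binom i (suc k) ≡ (fromℕℚ i - fromℕℚ k) * binom i k
binom-absorption i zero = trans (QP.*-identityˡ _)
  (trans (binom-1 i) (solve 1 (λ I → I := (I :- con 0ℚ) :* con 1ℚ) refl (fromℕℚ i)))
binom-absorption zero (suc k) = trans (QP.*-zeroʳ (fromℕℚ (suc (suc k)))) (sym (QP.*-zeroʳ (0ℚ - fromℕℚ (suc k))))
binom-absorption (suc i) (suc k) = trans lhs≡ (sym rhs≡)
  where
  open ≡-Reasoning
  I  = fromℕℚ i
  K  = fromℕℚ k
  C₀ = binom i k
  C₁ = binom i (suc k)
  lhs≡ : fromℕℚ (suc (suc k)) * (binom i (suc (suc k)) + C₁) ≡ (1ℚ + I) * C₁
  lhs≡ = begin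
    fromℕℚ (suc (suc k)) * (binom i (suc (suc k)) + C₁)
      ≡⟨ QP.*-distribˡ-+ (fromℕℚ (suc (suc k))) _ C₁ ⟩
    fromℕℚ (suc (suc k)) * binom i (suc (suc k)) + fromℕℚ (suc (suc k)) * C₁
      ≡⟨ cong₂ _+_ (binom-absorption i (suc k)) (cong (_* C₁) (fromℕℚ-suc (suc k))) ⟩
    (I - fromℕℚ (suc k)) * C₁ + (1ℚ + fromℕℚ (suc k)) * C₁
      ≡⟨ solve 3 (λ I K C → (I :- K) :* C :+ (con 1ℚ :+ K) :* C := (con 1ℚ :+ I) :* C) refl I (fromℕℚ (suc k)) C₁ ⟩
    (1ℚ + I) * C₁ ∎
  rhs≡ : (fromℕℚ (suc i) - fromℕℚ (suc k)) * (C₁ + C₀) ≡ (1ℚ + I) * C₁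
  rhs≡ = begin
    (fromℕℚ (suc i) - fromℕℚ (suc k)) * (C₁ + C₀)
      ≡⟨ cong₂ (λ a b → (a - b) * (C₁ + C₀)) (fromℕℚ-suc i) (fromℕℚ-suc k) ⟩
    ((1ℚ + I) - (1ℚ + K)) * (C₁ + C₀)
      ≡⟨ solve 4 (λ I K C₁ C₀ → ((con 1ℚ :+ I) :- (con 1ℚ :+ K)) :* (C₁ :+ C₀)
                               := (con 1ℚ :+ I) :* C₁ :- (con 1ℚ :+ K) :* C₁ :+ (I :- K) :* C₀) refl I K C₁ C₀ ⟩
    (1ℚ + I) * C₁ - (1ℚ + K) * C₁ + (I - K) * C₀
      ≡⟨ cong ((1ℚ + I) * C₁ - (1ℚ + K) * C₁ +_) (trans (sym (binom-absorption i k)) (cong (_* C₁) (fromℕℚ-suc k))) ⟩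
    (1ℚ + I) * C₁ - (1ℚ + K) * C₁ + (1ℚ + K) * C₁
      ≡⟨ solve 2 (λ a b → a :- b :+ b := a) refl ((1ℚ + I) * C₁) ((1ℚ + K) * C₁) ⟩
    (1ℚ + I) * C₁ ∎

-- binomShift i x j = C(x, j − i), and 0 for j < i
binomShift : ℕ → ℕ → ℕ → ℚ
binomShift zero    x j       = binom x j
binomShift (suc i) x zero    = 0ℚ
binomShift (suc i) x (suc j) = binomShift i x j

altBinomSum : ℕ → ℕ → (ℕ → ℚ) → ℚ
altBinomSum i N g = sumTo N (λ t → sign t * (binom i t * g t))

altBinomSum-cong : ∀ i N {g h : ℕ → ℚ} → (∀ t → g t ≡ h t) → altBinomSum i N g ≡ altBinomSum i N h
altBinomSum-cong i N g≗h = sumTo-cong N (λ t → cong (λ z → sign t * (binom i t * z)) (g≗h t))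

altBinomSum-difference : ∀ i N (g h : ℕ → ℚ) →
                         altBinomSum i N (λ t → g t - h t) ≡ altBinomSum i N g - altBinomSum i N h
altBinomSum-difference i N g h = trans
  (sumTo-cong N (λ t → solve 4 (λ s c x y → s :* (c :* (x :- y)) := s :* (c :* x) :- s :* (c :* y))
                                refl (sign t) (binom i t) (g t) (h t)))
  (sumTo-difference N _ _)

altBinomSum-neg : ∀ i N (g : ℕ → ℚ) → altBinomSum i N (λ t → - g t) ≡ - altBinomSum i N g
altBinomSum-neg i N g = trans
  (sumTo-cong N (λ t → solve 3 (λ s c x → s :* (c :* (:- x)) := :- (s :* (c :* x))) refl (sign t) (binom i t) (g t)))
  (sumTo-neg N _)

altBinomSum-≤ : ∀ {i N} g → i ℕ.≤ N → altBinomSum i N g ≡ altBinomSum i i g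
altBinomSum-≤ {i} {N} g i≤N = sumTo-vanishing i N _ i≤N λ t i<t →
  trans (cong (λ c → sign t * (c * g t)) (binom-< i<t))
        (trans (cong (sign t *_) (QP.*-zeroˡ (g t))) (QP.*-zeroʳ (sign t)))

altBinomSum-zero : ∀ N g → altBinomSum 0 N g ≡ g 0
altBinomSum-zero N g = trans (altBinomSum-≤ {N = N} g ℕ.z≤n) (solve 1 (λ x → con 1ℚ :* (con 1ℚ :* x) := x) refl (g 0))

altBinomSum-suc : ∀ i N g → altBinomSum (suc i) (suc N) g ≡ altBinomSum i (suc N) g - altBinomSum i N (g ∘ suc)
altBinomSum-suc i N g = begin
  altBinomSum (suc i) (suc N) g
    ≡⟨ sumTo-suc N _ ⟩
  g₀ + sumTo N (λ t → sign (suc t) * ((binom i (suc t) + binom i t) * g (suc t)))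
    ≡⟨ cong (g₀ +_) (trans (sumTo-cong N pascal) (sumTo-+ N _ _)) ⟩
  g₀ + (sumTo N (λ t → sign (suc t) * (binom i (suc t) * g (suc t))) + sumTo N (λ t → - (sign t * (binom i t * g (suc t)))))
    ≡⟨ cong (λ z → g₀ + (sumTo N (λ t → sign (suc t) * (binom i (suc t) * g (suc t))) + z)) (sumTo-neg N _) ⟩
  g₀ + (sumTo N (λ t → sign (suc t) * (binom i (suc t) * g (suc t))) - altBinomSum i N (g ∘ suc))
    ≡⟨ QP.+-assoc g₀ _ _ ⟨
  (g₀ + sumTo N (λ t → sign (suc t) * (binom i (suc t) * g (suc t)))) - altBinomSum i N (g ∘ suc)
    ≡⟨ cong (_- altBinomSum i N (g ∘ suc)) (sumTo-suc N _) ⟨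
  altBinomSum i (suc N) g - altBinomSum i N (g ∘ suc) ∎
  where
  open ≡-Reasoning
  g₀ = 1ℚ * (1ℚ * g 0)
  pascal : ∀ t → sign (suc t) * ((binom i (suc t) + binom i t) * g (suc t))
               ≡ sign (suc t) * (binom i (suc t) * g (suc t)) + - (sign t * (binom i t * g (suc t)))
  pascal t = solve 4 (λ s a b x → (:- s) :* ((a :+ b) :* x) := (:- s) :* (a :* x) :+ (:- (s :* (b :* x))))
                     refl (sign t) (binom i (suc t)) (binom i t) (g (suc t))

-- Pascal's rule for C(i + 1, t) leaves the sum for i of g t − g (t + 1) = −C(x + t, j − 1).
altBinomSum-binom : ∀ i N x j → i ℕ.≤ N →
                    altBinomSum i N (λ t → binom (x ℕ.+ t) j) ≡ sign i * binomShift i x j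
altBinomSum-binom zero N x j _ = trans (altBinomSum-zero N _)
  (trans (cong (λ y → binom y j) (NP.+-identityʳ x)) (sym (QP.*-identityˡ _)))
altBinomSum-binom (suc i) (suc N) x j (ℕ.s≤s i≤N) = begin
  altBinomSum (suc i) (suc N) g
    ≡⟨ altBinomSum-suc i N g ⟩
  altBinomSum i (suc N) g - altBinomSum i N (g ∘ suc)
    ≡⟨ cong (_- altBinomSum i N (g ∘ suc)) (trans (altBinomSum-≤ g (NP.m≤n⇒m≤1+n i≤N)) (sym (altBinomSum-≤ g i≤N))) ⟩
  altBinomSum i N g - altBinomSum i N (g ∘ suc)
    ≡⟨ altBinomSum-difference i N g (g ∘ suc) ⟨
  altBinomSum i N (λ t → g t - g (suc t))
    ≡⟨ differences j ⟩
  sign (suc i) * binomShift (suc i) x j ∎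
  where
  open ≡-Reasoning
  g : ℕ → ℚ
  g t = binom (x ℕ.+ t) j
  differences : ∀ j → altBinomSum i N (λ t → binom (x ℕ.+ t) j - binom (x ℕ.+ suc t) j)
                    ≡ sign (suc i) * binomShift (suc i) x j
  differences zero = begin
    altBinomSum i N (λ t → 1ℚ - 1ℚ)  ≡⟨ altBinomSum-difference i N _ _ ⟩
    altBinomSum i N (λ t → 1ℚ) - altBinomSum i N (λ t → 1ℚ)  ≡⟨ QP.+-inverseʳ (altBinomSum i N (λ t → 1ℚ)) ⟩
    0ℚ                                ≡⟨ QP.*-zeroʳ (sign (suc i)) ⟨
    sign (suc i) * 0ℚ                 ∎
  differences (suc j) = begin
    altBinomSum i N (λ t → binom (x ℕ.+ t) (suc j) - binom (x ℕ.+ suc t) (suc j))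
      ≡⟨ altBinomSum-cong i N pascal ⟩
    altBinomSum i N (λ t → - binom (x ℕ.+ t) j)
      ≡⟨ altBinomSum-neg i N _ ⟩
    - altBinomSum i N (λ t → binom (x ℕ.+ t) j)
      ≡⟨ cong -_ (altBinomSum-binom i N x j i≤N) ⟩
    - (sign i * binomShift i x j)
      ≡⟨ QP.neg-distribˡ-* (sign i) (binomShift i x j) ⟩
    sign (suc i) * binomShift (suc i) x (suc j) ∎
    where
    pascal : ∀ t → binom (x ℕ.+ t) (suc j) - binom (x ℕ.+ suc t) (suc j) ≡ - binom (x ℕ.+ t) j
    pascal t rewrite NP.+-suc x t =
      solve 2 (λ a b → a :- (a :+ b) := :- b) refl (binom (x ℕ.+ t) (suc j)) (binom (x ℕ.+ t) j)

-- Determinants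

Matrix : ℕ → Set
Matrix n = Fin n → Fin n → ℚ

minor : ∀ {n} → Fin (suc n) → Matrix (suc n) → Matrix n
minor r M a b = M (F.punchIn r a) (F.suc b)

det : (n : ℕ) → Matrix n → ℚ
det zero    M = 1ℚ
det (suc n) M = sum (λ r → sign (toℕ r) * (M r F.zero * det n (minor r M)))

laplaceTerm : ∀ n → Matrix (suc n) → Fin (suc n) → ℚ
laplaceTerm n M r = sign (toℕ r) * (M r F.zero * det n (minor r M))

laplaceTerm-minor≡0 : ∀ n (M : Matrix (suc n)) r → det n (minor r M) ≡ 0ℚ → laplaceTerm n M r ≡ 0ℚ
laplaceTerm-minor≡0 n M r d≡0 =
  trans (cong (λ d → sign (toℕ r) * (M r F.zero * d)) d≡0)
        (trans (cong (sign (toℕ r) *_) (QP.*-zeroʳ (M r F.zero))) (QP.*-zeroʳ (sign (toℕ r))))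

laplaceTerm-entry≡0 : ∀ n (M : Matrix (suc n)) r → M r F.zero ≡ 0ℚ → laplaceTerm n M r ≡ 0ℚ
laplaceTerm-entry≡0 n M r m≡0 =
  trans (cong (λ m → sign (toℕ r) * (m * det n (minor r M))) m≡0)
        (trans (cong (sign (toℕ r) *_) (QP.*-zeroˡ (det n (minor r M)))) (QP.*-zeroʳ (sign (toℕ r))))

det-cong : ∀ n {M N : Matrix n} → (∀ i j → M i j ≡ N i j) → det n M ≡ det n N
det-cong zero    M≗N = refl
det-cong (suc n) M≗N = sum-cong-≗ λ r →
  cong₂ (λ x y → sign (toℕ r) * (x * y)) (M≗N r F.zero) (det-cong n (λ a b → M≗N (F.punchIn r a) (F.suc b)))

term-linearInEntry : ∀ s m d a b m₁ m₂ d₁ d₂ → m ≡ a * m₁ + b * m₂ → d ≡ d₁ → d ≡ d₂ →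
                     s * (m * d) ≡ a * (s * (m₁ * d₁)) + b * (s * (m₂ * d₂))
term-linearInEntry s m d a b m₁ m₂ d₁ d₂ refl refl refl =
  solve 6 (λ s a b m₁ m₂ d → s :* ((a :* m₁ :+ b :* m₂) :* d) := a :* (s :* (m₁ :* d)) :+ b :* (s :* (m₂ :* d)))
        refl s a b m₁ m₂ d

term-linearInMinor : ∀ s m d a b d₁ d₂ → d ≡ a * d₁ + b * d₂ →
                     s * (m * d) ≡ a * (s * (m * d₁)) + b * (s * (m * d₂))
term-linearInMinor s m d a b d₁ d₂ refl =
  solve 6 (λ s a b m d₁ d₂ → s :* (m :* (a :* d₁ :+ b :* d₂)) := a :* (s :* (m :* d₁)) :+ b :* (s :* (m :* d₂)))
        refl s a b m d₁ d₂

det-row-linear : ∀ n (r : Fin n) (a b : ℚ) (M M₁ M₂ : Matrix n) →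
                 (∀ i → i ≢ r → ∀ j → M₁ i j ≡ M i j) → (∀ i → i ≢ r → ∀ j → M₂ i j ≡ M i j) →
                 (∀ j → M r j ≡ a * M₁ r j + b * M₂ r j) → det n M ≡ a * det n M₁ + b * det n M₂
det-row-linear (suc n) r a b M M₁ M₂ M₁≗M M₂≗M Mr =
  trans (sum-cong-≗ term) (sum-linear a b (laplaceTerm n M₁) (laplaceTerm n M₂))
  where
  term : ∀ i → laplaceTerm n M i ≡ a * laplaceTerm n M₁ i + b * laplaceTerm n M₂ i
  term i with i F.≟ r
  ... | yes refl = term-linearInEntry (sign (toℕ i)) _ (det n (minor i M)) a b _ _ (det n (minor i M₁)) (det n (minor i M₂))
    (Mr F.zero)
    (det-cong n (λ x y → sym (M₁≗M (F.punchIn i x) (FP.punchInᵢ≢i i x) (F.suc y))))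
    (det-cong n (λ x y → sym (M₂≗M (F.punchIn i x) (FP.punchInᵢ≢i i x) (F.suc y))))
  ... | no i≢r = trans (term-linearInMinor (sign (toℕ i)) (M i F.zero) _ a b _ _ (det-row-linear n r′ a b (minor i M) (minor i M₁) (minor i M₂)
                   (λ x x≢r′ y → M₁≗M _ (off x x≢r′) _) (λ x x≢r′ y → M₂≗M _ (off x x≢r′) _)
                   (λ y → subst (λ w → M w (F.suc y) ≡ a * M₁ w (F.suc y) + b * M₂ w (F.suc y))
                                (sym (FP.punchIn-punchOut i≢r)) (Mr (F.suc y)))))
                 (sym (cong₂ (λ x y → a * (sign (toℕ i) * (x * _)) + b * (sign (toℕ i) * (y * _)))
                             (M₁≗M i i≢r F.zero) (M₂≗M i i≢r F.zero)))
    where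
    r′ = F.punchOut i≢r
    off : ∀ x → x ≢ r′ → F.punchIn i x ≢ r
    off x x≢r′ e = x≢r′ (FP.punchIn-injective i _ _ (trans e (sym (FP.punchIn-punchOut i≢r))))

det-col-linear : ∀ n (c : Fin n) (a b : ℚ) (M M₁ M₂ : Matrix n) →
                 (∀ i j → j ≢ c → M₁ i j ≡ M i j) → (∀ i j → j ≢ c → M₂ i j ≡ M i j) →
                 (∀ i → M i c ≡ a * M₁ i c + b * M₂ i c) → det n M ≡ a * det n M₁ + b * det n M₂
det-col-linear (suc n) c a b M M₁ M₂ M₁≗M M₂≗M Mc =
  trans (sum-cong-≗ (term c M₁≗M M₂≗M Mc)) (sum-linear a b (laplaceTerm n M₁) (laplaceTerm n M₂))
  where
  term : ∀ c → (∀ i j → j ≢ c → M₁ i j ≡ M i j) → (∀ i j → j ≢ c → M₂ i j ≡ M i j) →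
         (∀ i → M i c ≡ a * M₁ i c + b * M₂ i c) →
         ∀ i → laplaceTerm n M i ≡ a * laplaceTerm n M₁ i + b * laplaceTerm n M₂ i
  term F.zero M₁≗M M₂≗M Mc i = term-linearInEntry (sign (toℕ i)) _ (det n (minor i M)) a b _ _ (det n (minor i M₁)) (det n (minor i M₂))
    (Mc i)
    (det-cong n (λ x y → sym (M₁≗M (F.punchIn i x) (F.suc y) (λ ()))))
    (det-cong n (λ x y → sym (M₂≗M (F.punchIn i x) (F.suc y) (λ ()))))
  term (F.suc c) M₁≗M M₂≗M Mc i = trans
    (term-linearInMinor (sign (toℕ i)) (M i F.zero) _ a b _ _ (det-col-linear n c a b (minor i M) (minor i M₁) (minor i M₂)
      (λ x y y≢c → M₁≗M _ _ (y≢c ∘ FP.suc-injective)) (λ x y y≢c → M₂≗M _ _ (y≢c ∘ FP.suc-injective)) (λ x → Mc _)))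
    (sym (cong₂ (λ x y → a * (sign (toℕ i) * (x * _)) + b * (sign (toℕ i) * (y * _)))
                (M₁≗M i F.zero (λ ())) (M₂≗M i F.zero (λ ()))))

det-zeroRow : ∀ n (M : Matrix n) p → (∀ j → M p j ≡ 0ℚ) → det n M ≡ 0ℚ
det-zeroRow n M p Mp≡0 = trans
  (det-row-linear n p 0ℚ 0ℚ M M M (λ _ _ _ → refl) (λ _ _ _ → refl)
     (λ j → trans (Mp≡0 j) (sym (cong (λ m → 0ℚ * m + 0ℚ * m) (Mp≡0 j)))))
  (solve 1 (λ d → con 0ℚ :* d :+ con 0ℚ :* d := con 0ℚ) refl (det n M))

det-scaleRows : ∀ n (s : Fin n → ℚ) (N : Matrix n) → det n (λ i j → s i * N i j) ≡ prodFin n s * det n N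
det-scaleRows zero    s N = refl
det-scaleRows (suc n) s N = trans (sum-cong-≗ term) (sym (*-distribˡ-sum (prodFin (suc n) s) (laplaceTerm n N)))
  where
  term : ∀ r → laplaceTerm n (λ i j → s i * N i j) r ≡ prodFin (suc n) s * laplaceTerm n N r
  term r = begin
    sign (toℕ r) * ((s r * N r F.zero) * det n (λ a b → s (F.punchIn r a) * N (F.punchIn r a) (F.suc b)))
      ≡⟨ cong (λ d → sign (toℕ r) * ((s r * N r F.zero) * d)) (det-scaleRows n (s ∘ F.punchIn r) (minor r N)) ⟩
    sign (toℕ r) * ((s r * N r F.zero) * (prodFin n (s ∘ F.punchIn r) * det n (minor r N)))
      ≡⟨ solve 5 (λ g a b c d → g :* ((a :* b) :* (c :* d)) := (a :* c) :* (g :* (b :* d))) refl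
                 (sign (toℕ r)) (s r) (N r F.zero) (prodFin n (s ∘ F.punchIn r)) (det n (minor r N)) ⟩
    (s r * prodFin n (s ∘ F.punchIn r)) * laplaceTerm n N r
      ≡⟨ cong (_* laplaceTerm n N r) (prodFin-removeAt n r s) ⟨
    prodFin (suc n) s * laplaceTerm n N r ∎
    where open ≡-Reasoning

det≡laplaceTerm : ∀ n (M : Matrix (suc n)) p → (∀ a → laplaceTerm n M (F.punchIn p a) ≡ 0ℚ) →
                  det (suc n) M ≡ laplaceTerm n M p
det≡laplaceTerm n M p others≡0 = begin
  sum (laplaceTerm n M)                                      ≡⟨ sum-remove {i = p} (laplaceTerm n M) ⟩
  laplaceTerm n M p + sum (laplaceTerm n M ∘ F.punchIn p)    ≡⟨ cong (laplaceTerm n M p +_) (sum-zero _ others≡0) ⟩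
  laplaceTerm n M p + 0ℚ                                     ≡⟨ QP.+-identityʳ _ ⟩
  laplaceTerm n M p                                          ∎
  where open ≡-Reasoning

det-firstColumnSingleton : ∀ n (M : Matrix (suc n)) p → (∀ i → i ≢ p → M i F.zero ≡ 0ℚ) →
                           det (suc n) M ≡ laplaceTerm n M p
det-firstColumnSingleton n M p M≡0 = det≡laplaceTerm n M p λ a →
  laplaceTerm-entry≡0 n M _ (M≡0 _ (FP.punchInᵢ≢i p a))

det-rowSingleton : ∀ n (M : Matrix (suc n)) p → (∀ j → M p (F.suc j) ≡ 0ℚ) → det (suc n) M ≡ laplaceTerm n M p
det-rowSingleton n M p Mp≡0 = det≡laplaceTerm n M p λ a →
  let r≢p = FP.punchInᵢ≢i p a in
  laplaceTerm-minor≡0 n M _ (det-zeroRow n _ (F.punchOut r≢p) λ b →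
    trans (cong (λ i → M i (F.suc b)) (FP.punchIn-punchOut r≢p)) (Mp≡0 b))

Adjacent : ∀ {n} → Fin n → Fin n → Set
Adjacent p q = toℕ q ≡ suc (toℕ p)

Adjacent⇒≢ : ∀ {n} {p q : Fin n} → Adjacent p q → p ≢ q
Adjacent⇒≢ q≡1+p refl = NP.1+n≢n (sym q≡1+p)

toℕ-punchIn : ∀ {n} (i : Fin (suc n)) (j : Fin n) →
              (toℕ j ℕ.< toℕ i × toℕ (F.punchIn i j) ≡ toℕ j) ⊎ (toℕ i ℕ.≤ toℕ j × toℕ (F.punchIn i j) ≡ suc (toℕ j))
toℕ-punchIn F.zero     j         = inj₂ (ℕ.z≤n , refl)
toℕ-punchIn (F.suc i) F.zero     = inj₁ (ℕ.s≤s ℕ.z≤n , refl)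
toℕ-punchIn (F.suc i) (F.suc j) with toℕ-punchIn i j
... | inj₁ (j<i , e) = inj₁ (ℕ.s≤s j<i , cong suc e)
... | inj₂ (i≤j , e) = inj₂ (ℕ.s≤s i≤j , cong suc e)

punchIn-reflects-Adjacent : ∀ {n} (i : Fin (suc n)) {p q : Fin n} →
                            Adjacent (F.punchIn i p) (F.punchIn i q) → Adjacent p q
punchIn-reflects-Adjacent i {p} {q} adj with toℕ-punchIn i p | toℕ-punchIn i q
... | inj₁ (_ , ep) | inj₁ (_ , eq) = trans (sym eq) (trans adj (cong suc ep))
... | inj₂ (_ , ep) | inj₂ (_ , eq) = NP.suc-injective (trans (sym eq) (trans adj (cong suc ep)))
... | inj₁ (p<i , ep) | inj₂ (i≤q , eq) = ⊥-elim (NP.<-irrefl refl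
      (NP.<-≤-trans p<i (subst (toℕ i ℕ.≤_) (NP.suc-injective (trans (sym eq) (trans adj (cong suc ep)))) i≤q)))
... | inj₂ (i≤p , ep) | inj₁ (q<i , eq) = ⊥-elim (NP.<-irrefl refl (NP.<-≤-trans q<i
      (NP.≤-trans i≤p (NP.≤-trans (NP.n≤1+n _) (NP.≤-trans (NP.n≤1+n _) (NP.≤-reflexive (sym (trans (sym eq) (trans adj (cong suc ep))))))))))

punchIn-Adjacent : ∀ {n} {p q : Fin (suc n)} → Adjacent p q → ∀ a →
                   (F.punchIn p a ≡ F.punchIn q a) ⊎ (F.punchIn p a ≡ q × F.punchIn q a ≡ p)
punchIn-Adjacent {p = p} {q} adj a with toℕ-punchIn p a | toℕ-punchIn q a
... | inj₁ (_ , ep) | inj₁ (_ , eq) = inj₁ (FP.toℕ-injective (trans ep (sym eq)))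
... | inj₂ (_ , ep) | inj₂ (_ , eq) = inj₁ (FP.toℕ-injective (trans ep (sym eq)))
... | inj₁ (a<p , _) | inj₂ (q≤a , _) = ⊥-elim (NP.<-irrefl refl
      (NP.<-≤-trans a<p (NP.≤-trans (NP.n≤1+n _) (NP.≤-trans (NP.≤-reflexive (sym adj)) q≤a))))
... | inj₂ (p≤a , ep) | inj₁ (a<q , eq) = inj₂ (FP.toℕ-injective (trans ep (trans (cong suc a≡p) (sym adj))) ,
                                                 FP.toℕ-injective (trans eq a≡p))
  where
  a≡p : toℕ a ≡ toℕ p
  a≡p = NP.≤-antisym (NP.≤-pred (subst (toℕ a ℕ.<_) adj a<q)) p≤a

det-adjacentRows : ∀ n (M : Matrix n) {p q : Fin n} → Adjacent p q → (∀ j → M p j ≡ M q j) → det n M ≡ 0ℚ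
det-adjacentRows (suc n) M {p} {q} adj Mp≡Mq = sum-pairCancel (laplaceTerm n M) (Adjacent⇒≢ adj) others≡0 cancel
  where
  others≡0 : ∀ i → i ≢ p → i ≢ q → laplaceTerm n M i ≡ 0ℚ
  others≡0 i i≢p i≢q = laplaceTerm-minor≡0 n M i (det-adjacentRows n (minor i M)
    (punchIn-reflects-Adjacent i (subst₂ Adjacent (sym (FP.punchIn-punchOut i≢p)) (sym (FP.punchIn-punchOut i≢q)) adj))
    (λ j → subst₂ (λ u v → M u (F.suc j) ≡ M v (F.suc j))
                  (sym (FP.punchIn-punchOut i≢p)) (sym (FP.punchIn-punchOut i≢q)) (Mp≡Mq (F.suc j))))
  minors≡ : ∀ a b → minor q M a b ≡ minor p M a b
  minors≡ a b with punchIn-Adjacent adj a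
  ... | inj₁ e        = cong (λ w → M w (F.suc b)) (sym e)
  ... | inj₂ (ep , eq) = trans (cong (λ w → M w (F.suc b)) eq) (trans (Mp≡Mq (F.suc b)) (cong (λ w → M w (F.suc b)) (sym ep)))
  cancel : laplaceTerm n M p + laplaceTerm n M q ≡ 0ℚ
  cancel = begin
    laplaceTerm n M p + sign (toℕ q) * (M q F.zero * det n (minor q M))
      ≡⟨ cong₂ (λ s x → laplaceTerm n M p + s * x) (cong sign adj)
               (cong₂ _*_ (sym (Mp≡Mq F.zero)) (det-cong n minors≡)) ⟩
    laplaceTerm n M p + (- sign (toℕ p)) * (M p F.zero * det n (minor p M))
      ≡⟨ solve 3 (λ s m d → s :* (m :* d) :+ (:- s) :* (m :* d) := con 0ℚ) refl
                 (sign (toℕ p)) (M p F.zero) (det n (minor p M)) ⟩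
    0ℚ ∎
    where open ≡-Reasoning

-- Laplace expansion along two equal first columns v; G evaluates the minor formed by the other rows of h.
doubleExpansion : ∀ m {X : Set} → ((Fin m → X) → ℚ) → (Fin (suc (suc m)) → X) → (Fin (suc (suc m)) → ℚ) → ℚ
doubleExpansion m G h v = sum λ r → sign (toℕ r) * (v r * sum λ r′ →
  sign (toℕ r′) * (v (F.punchIn r r′) * G (h ∘ F.punchIn r ∘ F.punchIn r′)))

-- The terms with r = 0 or r′ = 0 cancel in pairs.
doubleExpansion-peel : ∀ m {X : Set} (G : (Fin m → X) → ℚ) h v → doubleExpansion m G h v ≡
  sum λ s → sign (toℕ (F.suc s)) * (v (F.suc s) * sum λ s′ →
    sign (toℕ (F.suc s′)) * (v (F.suc (F.punchIn s s′)) * G (h ∘ F.punchIn (F.suc s) ∘ F.punchIn (F.suc s′))))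
doubleExpansion-peel m G h v = begin
  first + sum (λ s → sign (toℕ (F.suc s)) * (v (F.suc s) * inner (F.suc s)))
    ≡⟨ cong (first +_) (trans (sum-cong-≗ split) (∑-distrib-+ paired remaining)) ⟩
  first + (sum paired + sum remaining)
    ≡⟨ QP.+-assoc first _ _ ⟨
  (first + sum paired) + sum remaining
    ≡⟨ trans (cong (_+ sum remaining) first+paired≡0) (QP.+-identityˡ _) ⟩
  sum remaining ∎
  where
  open ≡-Reasoning
  inner : Fin (suc (suc m)) → ℚ
  inner r = sum λ r′ → sign (toℕ r′) * (v (F.punchIn r r′) * G (h ∘ F.punchIn r ∘ F.punchIn r′))
  first = sign 0 * (v F.zero * inner F.zero)
  firstRow innerTail paired remaining : Fin (suc m) → ℚ
  firstRow s = sign (toℕ s) * (v (F.suc s) * G (h ∘ F.suc ∘ F.punchIn s))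
  innerTail s = sum λ s′ →
    sign (toℕ (F.suc s′)) * (v (F.suc (F.punchIn s s′)) * G (h ∘ F.punchIn (F.suc s) ∘ F.punchIn (F.suc s′)))
  paired s = sign (toℕ (F.suc s)) * (v (F.suc s) * (1ℚ * (v F.zero * G (h ∘ F.suc ∘ F.punchIn s))))
  remaining s = sign (toℕ (F.suc s)) * (v (F.suc s) * innerTail s)
  split : ∀ s → sign (toℕ (F.suc s)) * (v (F.suc s) * inner (F.suc s)) ≡ paired s + remaining s
  split s = solve 4 (λ a b c d → a :* (b :* (c :+ d)) := a :* (b :* c) :+ a :* (b :* d)) refl
                    (sign (toℕ (F.suc s))) (v (F.suc s)) (1ℚ * (v F.zero * G (h ∘ F.suc ∘ F.punchIn s))) (innerTail s)
  first+paired≡0 : first + sum paired ≡ 0ℚ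
  first+paired≡0 = begin
    first + sum paired
      ≡⟨ cong (_+ sum paired) (trans (QP.*-identityˡ _) (*-distribˡ-sum (v F.zero) firstRow)) ⟩
    sum (λ s → v F.zero * firstRow s) + sum paired
      ≡⟨ ∑-distrib-+ (λ s → v F.zero * firstRow s) paired ⟨
    sum (λ s → v F.zero * firstRow s + paired s)
      ≡⟨ sum-zero (λ s → v F.zero * firstRow s + paired s) (λ s →
           solve 4 (λ a b c g → a :* (b :* (c :* g)) :+ (:- b) :* (c :* (con 1ℚ :* (a :* g))) := con 0ℚ)
                   refl (v F.zero) (sign (toℕ s)) (v (F.suc s)) (G (h ∘ F.suc ∘ F.punchIn s))) ⟩
    0ℚ ∎

-- After peeling, what is left is the double expansion of the rows 1, 2, … with h 0 absorbed into G.
doubleExpansion≡0 : ∀ m {X : Set} (G : (Fin m → X) → ℚ) → (∀ R R′ → (∀ a → R a ≡ R′ a) → G R ≡ G R′) →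
                    ∀ h v → doubleExpansion m G h v ≡ 0ℚ
doubleExpansion≡0 zero G G-cong h v = trans (doubleExpansion-peel zero G h v)
  (sum-zero (λ s → sign (toℕ (F.suc s)) * (v (F.suc s) * 0ℚ))
            (λ s → trans (cong (sign (toℕ (F.suc s)) *_) (QP.*-zeroʳ (v (F.suc s)))) (QP.*-zeroʳ (sign (toℕ (F.suc s))))))
doubleExpansion≡0 (suc m) {X} G G-cong h v = trans (doubleExpansion-peel (suc m) G h v)
  (trans (sum-cong-≗ shift) (doubleExpansion≡0 m G′ G′-cong (h ∘ F.suc) (v ∘ F.suc)))
  where
  G′ : (Fin m → X) → ℚ
  G′ R = G (h F.zero V∷ R)
  G′-cong : ∀ R R′ → (∀ a → R a ≡ R′ a) → G′ R ≡ G′ R′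
  G′-cong R R′ R≗R′ = G-cong _ _ λ { F.zero → refl ; (F.suc a) → R≗R′ a }
  shift : ∀ s → sign (toℕ (F.suc s)) * (v (F.suc s) * sum λ s′ →
                  sign (toℕ (F.suc s′)) * (v (F.suc (F.punchIn s s′)) * G (h ∘ F.punchIn (F.suc s) ∘ F.punchIn (F.suc s′))))
              ≡ sign (toℕ s) * (v (F.suc s) * sum λ s′ →
                  sign (toℕ s′) * (v (F.suc (F.punchIn s s′)) * G′ (h ∘ F.suc ∘ F.punchIn s ∘ F.punchIn s′)))
  shift s = begin
    (- sign (toℕ s)) * (v (F.suc s) * sum λ s′ → (- sign (toℕ s′)) * (v (F.suc (F.punchIn s s′)) * G (h ∘ F.punchIn (F.suc s) ∘ F.punchIn (F.suc s′))))
      ≡⟨ cong (λ x → (- sign (toℕ s)) * (v (F.suc s) * x)) (trans (sum-cong-≗ absorb) (sum-neg term′)) ⟩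
    (- sign (toℕ s)) * (v (F.suc s) * - sum λ s′ → sign (toℕ s′) * (v (F.suc (F.punchIn s s′)) * G′ (h ∘ F.suc ∘ F.punchIn s ∘ F.punchIn s′)))
      ≡⟨ solve 3 (λ a b c → (:- a) :* (b :* (:- c)) := a :* (b :* c)) refl (sign (toℕ s)) (v (F.suc s)) _ ⟩
    sign (toℕ s) * (v (F.suc s) * sum λ s′ → sign (toℕ s′) * (v (F.suc (F.punchIn s s′)) * G′ (h ∘ F.suc ∘ F.punchIn s ∘ F.punchIn s′))) ∎
    where
    open ≡-Reasoning
    term′ : Fin (suc m) → ℚ
    term′ s′ = sign (toℕ s′) * (v (F.suc (F.punchIn s s′)) * G′ (h ∘ F.suc ∘ F.punchIn s ∘ F.punchIn s′))
    absorb : ∀ s′ → (- sign (toℕ s′)) * (v (F.suc (F.punchIn s s′)) * G (h ∘ F.punchIn (F.suc s) ∘ F.punchIn (F.suc s′)))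
                  ≡ - (sign (toℕ s′) * (v (F.suc (F.punchIn s s′)) * G′ (h ∘ F.suc ∘ F.punchIn s ∘ F.punchIn s′)))
    absorb s′ = trans (cong (λ g → (- sign (toℕ s′)) * (v (F.suc (F.punchIn s s′)) * g))
                            (G-cong _ _ λ { F.zero → refl ; (F.suc a) → refl }))
                      (sym (QP.neg-distribˡ-* (sign (toℕ s′)) _))

det-adjacentColumns : ∀ n (M : Matrix (suc n)) (c : Fin n) → (∀ i → M i (F.inject₁ c) ≡ M i (F.suc c)) → det (suc n) M ≡ 0ℚ
det-adjacentColumns (suc n) M (F.suc c) M≗ =
  sum-zero _ (λ r → laplaceTerm-minor≡0 (suc n) M r (det-adjacentColumns n (minor r M) c (λ i → M≗ _)))
det-adjacentColumns (suc m) M F.zero M≗ = trans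
  (sum-cong-≗ λ r → cong (λ x → sign (toℕ r) * (M r F.zero * x))
     (sum-cong-≗ λ r′ → cong (λ x → sign (toℕ r′) * (x * det m (minor r′ (minor r M)))) (sym (M≗ (F.punchIn r r′)))))
  (doubleExpansion≡0 m (det m) (λ R R′ R≗R′ → det-cong m (λ a b → cong (λ w → w b) (R≗R′ a)))
     (λ i b → M i (F.suc (F.suc b))) (λ i → M i F.zero))

det-addAdjacentRow : ∀ n (M M′ : Matrix n) {p q : Fin n} (c : ℚ) → Adjacent p q →
                     (∀ i → i ≢ p → ∀ j → M′ i j ≡ M i j) → (∀ j → M′ p j ≡ M p j + c * M q j) → det n M′ ≡ det n M
det-addAdjacentRow n M M′ {p} {q} c adj M′≗M M′p = begin
  det n M′                         ≡⟨ det-row-linear n p 1ℚ c M′ M M[p≔q] (λ i i≢p j → sym (M′≗M i i≢p j))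
                                        (λ i i≢p j → trans (entry (updateAt-minimal i p M i≢p)) (sym (M′≗M i i≢p j)))
                                        (λ j → trans (M′p j) (cong₂ (λ x y → x + c * y) (sym (QP.*-identityˡ (M p j)))
                                                                    (sym (entry {j = j} (updateAt-updates p M))))) ⟩
  1ℚ * det n M + c * det n M[p≔q]  ≡⟨ cong (λ d → 1ℚ * det n M + c * d) (det-adjacentRows n M[p≔q] adj (λ j →
                                        trans (entry (updateAt-updates p M))
                                              (sym (entry (updateAt-minimal q p M (Adjacent⇒≢ adj ∘ sym)))))) ⟩
  1ℚ * det n M + c * 0ℚ            ≡⟨ solve 2 (λ d c → con 1ℚ :* d :+ c :* con 0ℚ := d) refl (det n M) c ⟩
  det n M                          ∎
  where
  open ≡-Reasoning
  M[p≔q] : Matrix n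
  M[p≔q] = updateAt M p (λ _ → M q)
  entry : ∀ {u w : Fin n → ℚ} {j} → u ≡ w → u j ≡ w j
  entry {j = j} = cong (λ row → row j)

det-addAdjacentColumn : ∀ n (M M′ : Matrix (suc n)) (c : Fin n) (a b : ℚ) →
                        (∀ i j → j ≢ F.suc c → M′ i j ≡ M i j) →
                        (∀ i → M′ i (F.suc c) ≡ a * M i (F.suc c) + b * M i (F.inject₁ c)) → det (suc n) M′ ≡ a * det (suc n) M
det-addAdjacentColumn n M M′ c a b M′≗M M′c = begin
  det (suc n) M′                      ≡⟨ det-col-linear (suc n) (F.suc c) a b M′ M M[c≔c₀] (λ i j j≢c → sym (M′≗M i j j≢c))
                                           (λ i j j≢c → trans (updateAt-minimal j (F.suc c) (M i) j≢c) (sym (M′≗M i j j≢c)))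
                                           (λ i → trans (M′c i) (cong (λ y → a * M i (F.suc c) + b * y)
                                                                      (sym (updateAt-updates (F.suc c) (M i))))) ⟩
  a * det (suc n) M + b * det (suc n) M[c≔c₀]
    ≡⟨ cong (λ d → a * det (suc n) M + b * d) (det-adjacentColumns n M[c≔c₀] c (λ i →
         trans (updateAt-minimal (F.inject₁ c) (F.suc c) (M i) inject₁≢suc) (sym (updateAt-updates (F.suc c) (M i))))) ⟩
  a * det (suc n) M + b * 0ℚ          ≡⟨ solve 3 (λ a d b → a :* d :+ b :* con 0ℚ := a :* d) refl a (det (suc n) M) b ⟩
  a * det (suc n) M                   ∎
  where
  open ≡-Reasoning
  M[c≔c₀] : Matrix (suc n)
  M[c≔c₀] i = updateAt (M i) (F.suc c) (λ _ → M i (F.inject₁ c))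
  inject₁≢suc : F.inject₁ c ≢ F.suc c
  inject₁≢suc e = NP.1+n≢n (sym (trans (sym (FP.toℕ-inject₁ c)) (cong toℕ e)))

-- Boxes and multilinearity

-- The points k with kᵢ ≤ dᵢ, nested as pairs so that equal coordinates give equal points without
-- function extensionality.
Box : (n : ℕ) → (Fin n → ℕ) → Set
Box zero    d = ⊤
Box (suc n) d = Fin (suc (d F.zero)) × Box n (d ∘ F.suc)

coord : ∀ {n d} → Box n d → (i : Fin n) → Fin (suc (d i))
coord {suc n} (a , u) F.zero    = a
coord {suc n} (a , u) (F.suc i) = coord u i

point : ∀ {n d} → Box n d → Fin n → ℕ
point u i = toℕ (coord u i)

tabulateBox : ∀ {n} d → ((i : Fin n) → Fin (suc (d i))) → Box n d
tabulateBox {zero}  d x = tt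
tabulateBox {suc n} d x = x F.zero , tabulateBox (d ∘ F.suc) (x ∘ F.suc)

coord-tabulateBox : ∀ {n} d x (i : Fin n) → coord (tabulateBox d x) i ≡ x i
coord-tabulateBox {suc n} d x F.zero    = refl
coord-tabulateBox {suc n} d x (F.suc i) = coord-tabulateBox (d ∘ F.suc) (x ∘ F.suc) i

coord-injective : ∀ {n d} (u u′ : Box n d) → (∀ i → coord u i ≡ coord u′ i) → u ≡ u′
coord-injective {zero}  tt       tt         _ = refl
coord-injective {suc n} (a , u) (a′ , u′) e = cong₂ _,_ (e F.zero) (coord-injective u u′ (e ∘ F.suc))

∑Box : ∀ {n} d → (Box n d → ℚ) → ℚ
∑Box {zero}  d f = f tt
∑Box {suc n} d f = sum λ a → ∑Box (d ∘ F.suc) (λ u → f (a , u))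

∑Box-cong : ∀ {n} d {f g : Box n d → ℚ} → (∀ u → f u ≡ g u) → ∑Box d f ≡ ∑Box d g
∑Box-cong {zero}  d f≗g = f≗g tt
∑Box-cong {suc n} d f≗g = sum-cong-≗ λ a → ∑Box-cong (d ∘ F.suc) (λ u → f≗g (a , u))

∑Box-*ˡ : ∀ {n} d c (f : Box n d → ℚ) → c * ∑Box d f ≡ ∑Box d (λ u → c * f u)
∑Box-*ˡ {zero}  d c f = refl
∑Box-*ˡ {suc n} d c f = trans (*-distribˡ-sum c (λ a → ∑Box (d ∘ F.suc) (λ u → f (a , u))))
                              (sum-cong-≗ λ a → ∑Box-*ˡ (d ∘ F.suc) c (λ u → f (a , u)))

sumTo≡sum : ∀ N (f : ℕ → ℚ) → sumTo N f ≡ sum {suc N} (f ∘ toℕ)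
sumTo≡sum zero    f = sym (QP.+-identityʳ (f 0))
sumTo≡sum (suc N) f = trans (sumTo-suc N f) (cong (f 0 +_) (sumTo≡sum N (f ∘ suc)))

boxSum-cong : ∀ n N {f g : (Fin n → ℕ) → ℚ} → (∀ k → f k ≡ g k) → boxSum n N f ≡ boxSum n N g
boxSum-cong zero    N f≗g = f≗g _
boxSum-cong (suc n) N f≗g = sumTo-cong N λ k → boxSum-cong n N λ ks → f≗g _

-- boxSum builds its index vectors with a pattern-matching lambda of its own, hence the hypothesis on f.
boxSum≡∑Box : ∀ n N (f : (Fin n → ℕ) → ℚ) → (∀ k k′ → (∀ i → k i ≡ k′ i) → f k ≡ f k′) →
              boxSum n N f ≡ ∑Box (λ _ → N) (f ∘ point)
boxSum≡∑Box zero    N f f-cong = f-cong _ _ (λ ())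
boxSum≡∑Box (suc n) N f f-cong = begin
  boxSum (suc n) N f
    ≡⟨ sumTo-cong N (λ k → boxSum-cong n N λ ks → f-cong _ (k V∷ ks) λ { F.zero → refl ; (F.suc i) → refl }) ⟩
  sumTo N (λ k → boxSum n N λ ks → f (k V∷ ks))
    ≡⟨ sumTo-cong N (λ k → boxSum≡∑Box n N (λ ks → f (k V∷ ks)) λ ks ks′ ks≗ks′ →
                             f-cong _ _ λ { F.zero → refl ; (F.suc i) → ks≗ks′ i }) ⟩
  sumTo N (λ k → ∑Box (λ _ → N) λ u → f (k V∷ point u))
    ≡⟨ sumTo≡sum N (λ k → ∑Box (λ _ → N) λ u → f (k V∷ point u)) ⟩
  sum {suc N} (λ a → ∑Box (λ _ → N) λ u → f (toℕ a V∷ point u))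
    ≡⟨ sum-cong-≗ {suc N} {x = λ a → ∑Box (λ _ → N) λ u → f (toℕ a V∷ point u)}
                  {y = λ a → ∑Box (λ _ → N) λ u → f (point {d = λ _ → N} (a , u))}
                  (λ a → ∑Box-cong (λ _ → N) λ u → f-cong (toℕ a V∷ point u) (point {d = λ _ → N} (a , u))
                                                             λ { F.zero → refl ; (F.suc i) → refl }) ⟩
  ∑Box {suc n} (λ _ → N) (λ u → f (point {d = λ _ → N} u)) ∎
  where open ≡-Reasoning

record Multilinear {n m} (D : (Fin n → Fin m → ℚ) → ℚ) : Set where
  field
    respects : ∀ R R′ → (∀ i j → R i j ≡ R′ i j) → D R ≡ D R′
    linear   : ∀ r R (u w : Fin m → ℚ) a b →
               D (updateAt R r λ _ j → a * u j + b * w j) ≡ a * D (updateAt R r λ _ → u) + b * D (updateAt R r λ _ → w)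

module _ {n m} {D : (Fin n → Fin m → ℚ) → ℚ} (D-ml : Multilinear D) where
  open Multilinear D-ml

  respects-row : ∀ r R {u w : Fin m → ℚ} → (∀ j → u j ≡ w j) → D (updateAt R r λ _ → u) ≡ D (updateAt R r λ _ → w)
  respects-row r R {u} {w} u≗w = respects _ _ entry
    where
    entry : ∀ i j → updateAt R r (λ _ → u) i j ≡ updateAt R r (λ _ → w) i j
    entry i j with i F.≟ r
    ... | yes refl = trans (cong (λ row → row j) (updateAt-updates i R))
                           (trans (u≗w j) (sym (cong (λ row → row j) (updateAt-updates i R))))
    ... | no i≢r   = trans (cong (λ row → row j) (updateAt-minimal i r R i≢r))
                           (sym (cong (λ row → row j) (updateAt-minimal i r R i≢r)))

  multilinear-sum : ∀ {k} r R (v : Fin k → Fin m → ℚ) →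
                    D (updateAt R r λ _ j → sum λ a → v a j) ≡ sum λ a → D (updateAt R r λ _ → v a)
  multilinear-sum {zero} r R v = begin
    D (updateAt R r λ _ _ → 0ℚ)
      ≡⟨ respects-row r R (λ _ → refl) ⟩
    D (updateAt R r λ _ _ → 0ℚ * 0ℚ + 0ℚ * 0ℚ)
      ≡⟨ linear r R (λ _ → 0ℚ) (λ _ → 0ℚ) 0ℚ 0ℚ ⟩
    0ℚ * D (updateAt R r λ _ _ → 0ℚ) + 0ℚ * D (updateAt R r λ _ _ → 0ℚ)
      ≡⟨ solve 1 (λ d → con 0ℚ :* d :+ con 0ℚ :* d := con 0ℚ) refl (D (updateAt R r λ _ _ → 0ℚ)) ⟩
    0ℚ ∎
    where open ≡-Reasoning
  multilinear-sum {suc k} r R v = begin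
    D (updateAt R r λ _ j → v F.zero j + rest j)
      ≡⟨ respects-row r R (λ j → sym (cong₂ _+_ (QP.*-identityˡ (v F.zero j)) (QP.*-identityˡ (rest j)))) ⟩
    D (updateAt R r λ _ j → 1ℚ * v F.zero j + 1ℚ * rest j)
      ≡⟨ linear r R (v F.zero) rest 1ℚ 1ℚ ⟩
    1ℚ * D (updateAt R r λ _ → v F.zero) + 1ℚ * D (updateAt R r λ _ → rest)
      ≡⟨ cong₂ _+_ (QP.*-identityˡ (D (updateAt R r λ _ → v F.zero))) (trans (QP.*-identityˡ _) (multilinear-sum r R (v ∘ F.suc))) ⟩
    D (updateAt R r λ _ → v F.zero) + sum (λ a → D (updateAt R r λ _ → v (F.suc a))) ∎
    where
    open ≡-Reasoning
    rest : Fin m → ℚ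
    rest j = sum λ a → v (F.suc a) j

multilinear-∑Box : ∀ {n m} {D : (Fin n → Fin m → ℚ) → ℚ} → Multilinear D → ∀ d (v : (i : Fin n) → Fin (suc (d i)) → Fin m → ℚ) →
                   ∑Box d (λ u → D (λ i → v i (coord u i))) ≡ D (λ i j → sum λ a → v i a j)
multilinear-∑Box {zero} {D = D} D-ml d v = Multilinear.respects D-ml (λ i → v i (coord {d = d} tt i)) _ (λ ())
multilinear-∑Box {suc n} {m} {D} D-ml d v = begin
  sum (λ a → ∑Box (d ∘ F.suc) (λ u → D (λ i → v i (coord {d = d} (a , u) i))))
    ≡⟨ sum-cong-≗ (λ a → trans (∑Box-cong (d ∘ F.suc) (λ u → respects (λ i → v i (coord {d = d} (a , u) i)) (v F.zero a V∷ (λ i → v (F.suc i) (coord u i)))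
                                                                    (λ { F.zero j → refl ; (F.suc i) j → refl })))
                               (multilinear-∑Box (fixFirst a) (d ∘ F.suc) (v ∘ F.suc))) ⟩
  sum (λ a → D (v F.zero a V∷ (S ∘ F.suc)))
    ≡⟨ sum-cong-≗ (λ a → respects (v F.zero a V∷ (S ∘ F.suc)) (updateAt S F.zero λ _ → v F.zero a)
                           (λ { F.zero j → sym (cong (λ row → row j) (updateAt-updates F.zero {λ _ → v F.zero a} S)) ; (F.suc i) j → refl })) ⟩
  sum (λ a → D (updateAt S F.zero λ _ → v F.zero a))
    ≡⟨ multilinear-sum D-ml F.zero S (v F.zero) ⟨
  D (updateAt S F.zero λ _ → S F.zero)
    ≡⟨ respects (updateAt S F.zero λ _ → S F.zero) S
                (λ { F.zero j → cong (λ row → row j) (updateAt-updates F.zero {λ _ → S F.zero} S) ; (F.suc i) j → refl }) ⟩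
  D S ∎
  where
  open ≡-Reasoning
  open Multilinear D-ml
  S : Fin (suc n) → Fin m → ℚ
  S i j = sum λ a → v i a j
  fixFirst : ∀ a → Multilinear (λ R → D (v F.zero a V∷ R))
  fixFirst a = record
    { respects = λ R R′ R≗R′ → respects (v F.zero a V∷ R) (v F.zero a V∷ R′) λ { F.zero j → refl ; (F.suc i) j → R≗R′ i j }
    ; linear   = λ r R u w x y →
        let row₀ = v F.zero a
            upd  = λ (z : Fin m → ℚ) → updateAt R r λ _ → z
            upd′ = λ (z : Fin m → ℚ) → updateAt (row₀ V∷ R) (F.suc r) λ _ → z
            same = λ (z : Fin m → ℚ) → respects (row₀ V∷ upd z) (upd′ z) (λ { F.zero j → refl ; (F.suc i) j → refl })
        in begin
        D (row₀ V∷ upd (λ j → x * u j + y * w j))            ≡⟨ same (λ j → x * u j + y * w j) ⟩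
        D (upd′ (λ j → x * u j + y * w j))                   ≡⟨ linear (F.suc r) (row₀ V∷ R) u w x y ⟩
        x * D (upd′ u) + y * D (upd′ w)                       ≡⟨ cong₂ (λ p q → x * p + y * q) (same u) (same w) ⟨
        x * D (row₀ V∷ upd u) + y * D (row₀ V∷ upd w)         ∎ }

det-multilinear : ∀ n → Multilinear (det n)
det-multilinear n = record
  { respects = λ R R′ → det-cong n
  ; linear   = λ r R u w a b → det-row-linear n r a b _ _ _
      (λ i i≢r j → trans (entry (updateAt-minimal i r R i≢r)) (sym (entry (updateAt-minimal i r R i≢r))))
      (λ i i≢r j → trans (entry (updateAt-minimal i r R i≢r)) (sym (entry (updateAt-minimal i r R i≢r))))
      (λ j → trans (entry (updateAt-updates r R))
                   (sym (cong₂ (λ p q → a * p + b * q) (entry (updateAt-updates r R)) (entry (updateAt-updates r R)))))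
  }
  where
  entry : ∀ {u w : Fin n → ℚ} {j} → u ≡ w → u j ≡ w j
  entry {j = j} = cong (λ row → row j)

-- Binomial determinants

binomDet : (n : ℕ) → (Fin n → ℕ) → ℚ
binomDet n x = det n (λ i j → binom (x i) (toℕ j))

binomDet-cong : ∀ n {x y : Fin n → ℕ} → (∀ i → x i ≡ y i) → binomDet n x ≡ binomDet n y
binomDet-cong n x≗y = det-cong n (λ i j → cong (λ z → binom z (toℕ j)) (x≗y i))

-- Column operations turn the columns j > t of the binomial matrix into (xᵢ - x₀) C(xᵢ, j - 1).
module ReducedColumns (n : ℕ) (x : Fin (suc n) → ℕ) where
  X : Fin (suc n) → ℚ
  X i = fromℕℚ (x i)

  reducedEntry : Fin (suc n) → ℕ → ℚ
  reducedEntry i zero    = 1ℚ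
  reducedEntry i (suc j) = (X i - X F.zero) * binom (x i) j

  reduced : ℕ → Matrix (suc n)
  reduced t i j with toℕ j ℕ.≤? t
  ... | yes _ = binom (x i) (toℕ j)
  ... | no  _ = reducedEntry i (toℕ j)

  reduced-≤ : ∀ t i j → toℕ j ℕ.≤ t → reduced t i j ≡ binom (x i) (toℕ j)
  reduced-≤ t i j j≤t with toℕ j ℕ.≤? t
  ... | yes _   = refl
  ... | no  j≰t = ⊥-elim (j≰t j≤t)

  reduced-> : ∀ t i j → ¬ (toℕ j ℕ.≤ t) → reduced t i j ≡ reducedEntry i (toℕ j)
  reduced-> t i j j≰t with toℕ j ℕ.≤? t
  ... | yes j≤t = ⊥-elim (j≰t j≤t)
  ... | no  _   = refl

  -- (t+1) C(x, t+1) + (t - x₀) C(x, t) = (x - x₀) C(x, t) by absorption.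
  reduced-step : ∀ t → t ℕ.< n → det (suc n) (reduced t) ≡ fromℕℚ (suc t) * det (suc n) (reduced (suc t))
  reduced-step t t<n = det-addAdjacentColumn n (reduced (suc t)) (reduced t) c (fromℕℚ (suc t)) (fromℕℚ t - X F.zero) others column
    where
    c = F.fromℕ< t<n
    toℕc : toℕ c ≡ t
    toℕc = FP.toℕ-fromℕ< t<n
    others : ∀ i j → j ≢ F.suc c → reduced t i j ≡ reduced (suc t) i j
    others i j j≢c = byCases (toℕ j ℕ.≤? t)
      where
      byCases : Dec (toℕ j ℕ.≤ t) → reduced t i j ≡ reduced (suc t) i j
      byCases (yes j≤t) = trans (reduced-≤ t i j j≤t) (sym (reduced-≤ (suc t) i j (NP.m≤n⇒m≤1+n j≤t)))
      byCases (no  j≰t) = trans (reduced-> t i j j≰t) (sym (reduced-> (suc t) i j λ j≤1+t → j≢c (FP.toℕ-injective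
        (NP.≤-antisym (subst (toℕ j ℕ.≤_) (cong suc (sym toℕc)) j≤1+t)
                      (subst (ℕ._≤ toℕ j) (cong suc (sym toℕc)) (NP.≰⇒> j≰t))))))
    column : ∀ i → reduced t i (F.suc c) ≡ fromℕℚ (suc t) * reduced (suc t) i (F.suc c) + (fromℕℚ t - X F.zero) * reduced (suc t) i (F.inject₁ c)
    column i = begin
      reduced t i (F.suc c)
        ≡⟨ reduced-> t i (F.suc c) (λ 1+c≤t → NP.<-irrefl refl (subst (ℕ._≤ t) (cong suc toℕc) 1+c≤t)) ⟩
      (X i - X F.zero) * binom (x i) (toℕ c)
        ≡⟨ cong (λ k → (X i - X F.zero) * binom (x i) k) toℕc ⟩
      (X i - X F.zero) * binom (x i) t
        ≡⟨ solve 4 (λ I Z T C → (I :- Z) :* C := (I :- T) :* C :+ (T :- Z) :* C) refl (X i) (X F.zero) (fromℕℚ t) (binom (x i) t) ⟩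
      (X i - fromℕℚ t) * binom (x i) t + (fromℕℚ t - X F.zero) * binom (x i) t
        ≡⟨ cong (_+ (fromℕℚ t - X F.zero) * binom (x i) t) (binom-absorption (x i) t) ⟨
      fromℕℚ (suc t) * binom (x i) (suc t) + (fromℕℚ t - X F.zero) * binom (x i) t
        ≡⟨ cong₂ (λ p q → fromℕℚ (suc t) * p + (fromℕℚ t - X F.zero) * q)
                 (trans (cong (λ k → binom (x i) (suc k)) (sym toℕc)) (sym (reduced-≤ (suc t) i (F.suc c) (ℕ.s≤s (NP.≤-reflexive toℕc)))))
                 (trans (cong (binom (x i)) (sym toℕinject₁c)) (sym (reduced-≤ (suc t) i (F.inject₁ c) (NP.≤-trans (NP.≤-reflexive toℕinject₁c) (NP.n≤1+n t))))) ⟩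
      fromℕℚ (suc t) * reduced (suc t) i (F.suc c) + (fromℕℚ t - X F.zero) * reduced (suc t) i (F.inject₁ c) ∎
      where
      open ≡-Reasoning
      toℕinject₁c : toℕ (F.inject₁ c) ≡ t
      toℕinject₁c = trans (FP.toℕ-inject₁ c) toℕc

  reduced-telescope : ∀ t → t ℕ.≤ n → det (suc n) (reduced 0) ≡ poch 1ℚ t * det (suc n) (reduced t)
  reduced-telescope zero    _     = sym (QP.*-identityˡ _)
  reduced-telescope (suc t) 1+t≤n = begin
    det (suc n) (reduced 0)                                          ≡⟨ reduced-telescope t (NP.<⇒≤ 1+t≤n) ⟩
    poch 1ℚ t * det (suc n) (reduced t)                              ≡⟨ cong (poch 1ℚ t *_) (reduced-step t 1+t≤n) ⟩
    poch 1ℚ t * (fromℕℚ (suc t) * det (suc n) (reduced (suc t)))     ≡⟨ QP.*-assoc (poch 1ℚ t) _ _ ⟨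
    (poch 1ℚ t * fromℕℚ (suc t)) * det (suc n) (reduced (suc t))     ≡⟨ cong (λ k → (poch 1ℚ t * k) * det (suc n) (reduced (suc t))) (fromℕℚ-suc t) ⟩
    poch 1ℚ (suc t) * det (suc n) (reduced (suc t))                  ∎
    where open ≡-Reasoning

  reduced-zero : det (suc n) (reduced 0) ≡ prodFin n (λ a → X (F.suc a) - X F.zero) * binomDet n (x ∘ F.suc)
  reduced-zero = begin
    det (suc n) (reduced 0)
      ≡⟨ det-rowSingleton n (reduced 0) F.zero (λ j → trans (reduced-> 0 F.zero (F.suc j) λ ())
                                                             (trans (cong (_* binom (x F.zero) (toℕ j)) (QP.+-inverseʳ (X F.zero))) (QP.*-zeroˡ (binom (x F.zero) (toℕ j))))) ⟩
    1ℚ * (reduced 0 F.zero F.zero * det n (minor F.zero (reduced 0)))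
      ≡⟨ cong (λ e → 1ℚ * (e * det n (minor F.zero (reduced 0)))) (reduced-≤ 0 F.zero F.zero ℕ.z≤n) ⟩
    1ℚ * (1ℚ * det n (minor F.zero (reduced 0)))
      ≡⟨ trans (QP.*-identityˡ _) (QP.*-identityˡ _) ⟩
    det n (minor F.zero (reduced 0))
      ≡⟨ det-cong n (λ a b → reduced-> 0 (F.suc a) (F.suc b) λ ()) ⟩
    det n (λ a b → (X (F.suc a) - X F.zero) * binom (x (F.suc a)) (toℕ b))
      ≡⟨ det-scaleRows n (λ a → X (F.suc a) - X F.zero) _ ⟩
    prodFin n (λ a → X (F.suc a) - X F.zero) * binomDet n (x ∘ F.suc) ∎
    where open ≡-Reasoning

binomDet-suc : ∀ n (x : Fin (suc n) → ℕ) →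
               poch 1ℚ n * binomDet (suc n) x ≡ prodFin n (λ a → fromℕℚ (x (F.suc a)) - fromℕℚ (x F.zero)) * binomDet n (x ∘ F.suc)
binomDet-suc n x = begin
  poch 1ℚ n * binomDet (suc n) x      ≡⟨ cong (poch 1ℚ n *_) (det-cong (suc n) λ i j → sym (reduced-≤ n i j (NP.≤-pred (FP.toℕ<n j)))) ⟩
  poch 1ℚ n * det (suc n) (reduced n) ≡⟨ reduced-telescope n NP.≤-refl ⟨
  det (suc n) (reduced 0)             ≡⟨ reduced-zero ⟩
  prodFin n (λ a → X (F.suc a) - X F.zero) * binomDet n (x ∘ F.suc) ∎
  where
  open ≡-Reasoning
  open ReducedColumns n x

Δ : (n : ℕ) → (Fin n → ℚ) → ℚ
Δ zero    Y = 1ℚ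
Δ (suc n) Y = prodFin n (λ j → Y F.zero - Y (F.suc j)) * Δ n (Y ∘ F.suc)

Δ-cong : ∀ n {Y Z : Fin n → ℚ} → (∀ i → Y i ≡ Z i) → Δ n Y ≡ Δ n Z
Δ-cong zero    Y≗Z = refl
Δ-cong (suc n) Y≗Z = cong₂ _*_ (prodFin-cong n (λ j → cong₂ _-_ (Y≗Z F.zero) (Y≗Z (F.suc j)))) (Δ-cong n (Y≗Z ∘ F.suc))

superfactorial : ℕ → ℚ
superfactorial zero    = 1ℚ
superfactorial (suc n) = poch 1ℚ n * superfactorial n

-- σ n = (-1)^(n(n-1)/2)
σ : ℕ → ℚ
σ zero    = 1ℚ
σ (suc n) = sign n * σ n

σ²≡1 : ∀ n → σ n * σ n ≡ 1ℚ
σ²≡1 zero    = refl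
σ²≡1 (suc n) = trans (solve 2 (λ s t → (s :* t) :* (s :* t) := (s :* s) :* (t :* t)) refl (sign n) (σ n))
                     (trans (cong₂ _*_ (sign²≡1 n) (σ²≡1 n)) refl)

σ≡prodFin-sign : ∀ n → σ n ≡ prodFin n (sign ∘ toℕ)
σ≡prodFin-sign zero    = refl
σ≡prodFin-sign (suc n) = sym (begin
  1ℚ * prodFin n (λ i → - sign (toℕ i)) ≡⟨ QP.*-identityˡ _ ⟩
  prodFin n (λ i → - sign (toℕ i))      ≡⟨ prodFin-neg n (sign ∘ toℕ) ⟩
  sign n * prodFin n (sign ∘ toℕ)       ≡⟨ cong (sign n *_) (σ≡prodFin-sign n) ⟨
  sign n * σ n                          ∎)
  where open ≡-Reasoning

vandermonde : ∀ n (x : Fin n → ℕ) → superfactorial n * binomDet n x ≡ σ n * Δ n (fromℕℚ ∘ x)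
vandermonde zero    x = refl
vandermonde (suc n) x = begin
  (poch 1ℚ n * superfactorial n) * binomDet (suc n) x
    ≡⟨ solve 3 (λ p s w → (p :* s) :* w := s :* (p :* w)) refl (poch 1ℚ n) (superfactorial n) (binomDet (suc n) x) ⟩
  superfactorial n * (poch 1ℚ n * binomDet (suc n) x)
    ≡⟨ cong (superfactorial n *_) (binomDet-suc n x) ⟩
  superfactorial n * (P * binomDet n (x ∘ F.suc))
    ≡⟨ solve 3 (λ s p w → s :* (p :* w) := p :* (s :* w)) refl (superfactorial n) P (binomDet n (x ∘ F.suc)) ⟩
  P * (superfactorial n * binomDet n (x ∘ F.suc))
    ≡⟨ cong (P *_) (vandermonde n (x ∘ F.suc)) ⟩
  P * (σ n * Δ n (X ∘ F.suc))
    ≡⟨ cong (_* (σ n * Δ n (X ∘ F.suc))) (trans (prodFin-cong n (λ a → solve 2 (λ u v → u :- v := :- (v :- u)) refl (X (F.suc a)) (X F.zero)))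
                                                 (prodFin-neg n (λ a → X F.zero - X (F.suc a)))) ⟩
  (sign n * P₀) * (σ n * Δ n (X ∘ F.suc))
    ≡⟨ solve 4 (λ s p t q → (s :* p) :* (t :* q) := (s :* t) :* (p :* q)) refl (sign n) P₀ (σ n) (Δ n (X ∘ F.suc)) ⟩
  σ (suc n) * Δ (suc n) X ∎
  where
  open ≡-Reasoning
  X : Fin (suc n) → ℚ
  X = fromℕℚ ∘ x
  P  = prodFin n (λ a → X (F.suc a) - X F.zero)
  P₀ = prodFin n (λ a → X F.zero - X (F.suc a))

module Differenced (n : ℕ) (x : Fin (suc n) → ℕ) where
  -- x as a function on ℕ, with junk value 0 beyond n
  xAt : ℕ → ℕ
  xAt m with m ℕ.<? suc n
  ... | yes m<1+n = x (F.fromℕ< m<1+n)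
  ... | no  _     = 0

  xAt-toℕ : ∀ i → xAt (toℕ i) ≡ x i
  xAt-toℕ i with toℕ i ℕ.<? suc n
  ... | yes i<1+n = cong x (FP.fromℕ<-toℕ i i<1+n)
  ... | no  i≮1+n = ⊥-elim (i≮1+n (FP.toℕ<n i))

  differenced : ℕ → Matrix (suc n)
  differenced k i j with toℕ i ℕ.<? k
  ... | yes _ = binom (xAt (toℕ i)) (toℕ j) - binom (xAt (suc (toℕ i))) (toℕ j)
  ... | no  _ = binom (xAt (toℕ i)) (toℕ j)

  differenced-< : ∀ k i j → toℕ i ℕ.< k → differenced k i j ≡ binom (xAt (toℕ i)) (toℕ j) - binom (xAt (suc (toℕ i))) (toℕ j)
  differenced-< k i j i<k with toℕ i ℕ.<? k
  ... | yes _   = refl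
  ... | no  i≮k = ⊥-elim (i≮k i<k)

  differenced-≥ : ∀ k i j → ¬ (toℕ i ℕ.< k) → differenced k i j ≡ binom (xAt (toℕ i)) (toℕ j)
  differenced-≥ k i j i≮k with toℕ i ℕ.<? k
  ... | yes i<k = ⊥-elim (i≮k i<k)
  ... | no  _   = refl

  differenced-step : ∀ k → k ℕ.< n → det (suc n) (differenced (suc k)) ≡ det (suc n) (differenced k)
  differenced-step k k<n = det-addAdjacentRow (suc n) (differenced k) (differenced (suc k)) (- 1ℚ) adjacent others row
    where
    p = F.fromℕ< (NP.m<n⇒m<1+n k<n)
    q = F.fromℕ< (ℕ.s≤s k<n)
    toℕp : toℕ p ≡ k
    toℕp = FP.toℕ-fromℕ< (NP.m<n⇒m<1+n k<n)
    toℕq : toℕ q ≡ suc k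
    toℕq = FP.toℕ-fromℕ< (ℕ.s≤s k<n)
    adjacent : Adjacent p q
    adjacent = trans toℕq (cong suc (sym toℕp))
    others : ∀ i → i ≢ p → ∀ j → differenced (suc k) i j ≡ differenced k i j
    others i i≢p j = byCases (toℕ i ℕ.<? k)
      where
      byCases : Dec (toℕ i ℕ.< k) → differenced (suc k) i j ≡ differenced k i j
      byCases (yes i<k) = trans (differenced-< (suc k) i j (NP.m<n⇒m<1+n i<k)) (sym (differenced-< k i j i<k))
      byCases (no  i≮k) = trans (differenced-≥ (suc k) i j λ i<1+k → i≢p (FP.toℕ-injective
                                  (trans (NP.≤-antisym (NP.≤-pred i<1+k) (NP.≮⇒≥ i≮k)) (sym toℕp))))
                                (sym (differenced-≥ k i j i≮k))
    row : ∀ j → differenced (suc k) p j ≡ differenced k p j + (- 1ℚ) * differenced k q j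
    row j = begin
      differenced (suc k) p j
        ≡⟨ differenced-< (suc k) p j (subst (ℕ._< suc k) (sym toℕp) (NP.n<1+n k)) ⟩
      binom (xAt (toℕ p)) (toℕ j) - binom (xAt (suc (toℕ p))) (toℕ j)
        ≡⟨ cong (λ m → binom (xAt (toℕ p)) (toℕ j) - binom (xAt m) (toℕ j)) (sym adjacent) ⟩
      binom (xAt (toℕ p)) (toℕ j) - binom (xAt (toℕ q)) (toℕ j)
        ≡⟨ solve 2 (λ a b → a :- b := a :+ (:- con 1ℚ) :* b) refl (binom (xAt (toℕ p)) (toℕ j)) (binom (xAt (toℕ q)) (toℕ j)) ⟩
      binom (xAt (toℕ p)) (toℕ j) + (- 1ℚ) * binom (xAt (toℕ q)) (toℕ j)
        ≡⟨ cong₂ (λ u w → u + (- 1ℚ) * w) (differenced-≥ k p j (NP.<-irrefl toℕp))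
                 (differenced-≥ k q j (λ q<k → NP.<-asym q<k (subst (k ℕ.<_) (sym toℕq) (NP.n<1+n k)))) ⟨
      differenced k p j + (- 1ℚ) * differenced k q j ∎
      where open ≡-Reasoning

  differenced-telescope : ∀ k → k ℕ.≤ n → det (suc n) (differenced k) ≡ binomDet (suc n) x
  differenced-telescope zero    _     = det-cong (suc n) λ i j →
    trans (differenced-≥ 0 i j λ ()) (cong (λ m → binom m (toℕ j)) (xAt-toℕ i))
  differenced-telescope (suc k) 1+k≤n = trans (differenced-step k 1+k≤n) (differenced-telescope k (NP.<⇒≤ 1+k≤n))

  last = F.fromℕ n

  toℕ-punchIn-last : ∀ (a : Fin n) → toℕ (F.punchIn last a) ≡ toℕ a
  toℕ-punchIn-last a with toℕ-punchIn last a
  ... | inj₁ (_ , e)    = e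
  ... | inj₂ (n≤a , _) = ⊥-elim (NP.<-irrefl refl (NP.<-≤-trans (FP.toℕ<n a) (subst (ℕ._≤ toℕ a) (FP.toℕ-fromℕ n) n≤a)))

  differenced-last : det (suc n) (differenced n) ≡
                     sign n * det n (λ a b → binom (x (F.inject₁ a)) (suc (toℕ b)) - binom (x (F.suc a)) (suc (toℕ b)))
  differenced-last = begin
    det (suc n) (differenced n)
      ≡⟨ det-firstColumnSingleton n (differenced n) last firstColumn ⟩
    sign (toℕ last) * (differenced n last F.zero * det n (minor last (differenced n)))
      ≡⟨ cong₂ (λ m e → sign m * (e * det n (minor last (differenced n)))) (FP.toℕ-fromℕ n)
               (differenced-≥ n last F.zero (NP.<-irrefl (FP.toℕ-fromℕ n))) ⟩
    sign n * (1ℚ * det n (minor last (differenced n)))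
      ≡⟨ cong (sign n *_) (trans (QP.*-identityˡ _) (det-cong n entries)) ⟩
    sign n * det n (λ a b → binom (x (F.inject₁ a)) (suc (toℕ b)) - binom (x (F.suc a)) (suc (toℕ b))) ∎
    where
    open ≡-Reasoning
    firstColumn : ∀ i → i ≢ last → differenced n i F.zero ≡ 0ℚ
    firstColumn i i≢last = trans (differenced-< n i F.zero (NP.≤∧≢⇒< (NP.≤-pred (FP.toℕ<n i))
                                   (λ e → i≢last (FP.toℕ-injective (trans e (sym (FP.toℕ-fromℕ n)))))))
                                 (QP.+-inverseʳ 1ℚ)
    entries : ∀ a b → minor last (differenced n) a b ≡ binom (x (F.inject₁ a)) (suc (toℕ b)) - binom (x (F.suc a)) (suc (toℕ b))
    entries a b = trans (differenced-< n (F.punchIn last a) (F.suc b) (subst (ℕ._< n) (sym (toℕ-punchIn-last a)) (FP.toℕ<n a)))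
      (cong₂ (λ u w → binom u (suc (toℕ b)) - binom w (suc (toℕ b)))
        (trans (cong xAt (trans (toℕ-punchIn-last a) (sym (FP.toℕ-inject₁ a)))) (xAt-toℕ (F.inject₁ a)))
        (trans (cong (xAt ∘ suc) (toℕ-punchIn-last a)) (xAt-toℕ (F.suc a))))

-- Subtracting from each row the next one and expanding along the first column leaves the rows
-- C(xᵢ, j + 1) − C(xᵢ₊₁, j + 1) = ∑_{t ≤ dᵢ} C(xᵢ₊₁ + t, j).
binomDet-branching : ∀ n (x : Fin (suc n) → ℕ) (d : Fin n → ℕ) → (∀ i → suc (x (F.suc i) ℕ.+ d i) ≡ x (F.inject₁ i)) →
                     binomDet (suc n) x ≡ sign n * ∑Box d (λ u → binomDet n (λ i → x (F.suc i) ℕ.+ point u i))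
binomDet-branching n x d x-gaps = begin
  binomDet (suc n) x
    ≡⟨ differenced-telescope n NP.≤-refl ⟨
  det (suc n) (differenced n)
    ≡⟨ differenced-last ⟩
  sign n * det n (λ a b → binom (x (F.inject₁ a)) (suc (toℕ b)) - binom (x (F.suc a)) (suc (toℕ b)))
    ≡⟨ cong (sign n *_) (det-cong n λ a b → sym (hockeyStick a b)) ⟩
  sign n * det n (λ a b → sum {suc (d a)} λ t → binom (x (F.suc a) ℕ.+ toℕ t) (toℕ b))
    ≡⟨ cong (sign n *_) (multilinear-∑Box (det-multilinear n) d (λ a t b → binom (x (F.suc a) ℕ.+ toℕ t) (toℕ b))) ⟨
  sign n * ∑Box d (λ u → binomDet n (λ i → x (F.suc i) ℕ.+ point u i)) ∎
  where
  open ≡-Reasoning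
  open Differenced n x
  hockeyStick : ∀ a b → sum {suc (d a)} (λ t → binom (x (F.suc a) ℕ.+ toℕ t) (toℕ b))
                      ≡ binom (x (F.inject₁ a)) (suc (toℕ b)) - binom (x (F.suc a)) (suc (toℕ b))
  hockeyStick a b = begin
    sum {suc (d a)} (λ t → binom (x (F.suc a) ℕ.+ toℕ t) (toℕ b))
      ≡⟨ sumTo≡sum (d a) (λ t → binom (x (F.suc a) ℕ.+ t) (toℕ b)) ⟨
    sumTo (d a) (λ t → binom (x (F.suc a) ℕ.+ t) (toℕ b))
      ≡⟨ binom-hockeyStick (x (F.suc a)) (d a) (toℕ b) ⟩
    binom (suc (x (F.suc a) ℕ.+ d a)) (suc (toℕ b)) - binom (x (F.suc a)) (suc (toℕ b))
      ≡⟨ cong (λ m → binom m (suc (toℕ b)) - binom (x (F.suc a)) (suc (toℕ b))) (x-gaps a) ⟩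
    binom (x (F.inject₁ a)) (suc (toℕ b)) - binom (x (F.suc a)) (suc (toℕ b)) ∎

-- The Holman series

poch-1-suc : ∀ m → poch 1ℚ (suc m) ≡ poch 1ℚ m * fromℕℚ (suc m)
poch-1-suc m = cong (poch 1ℚ m *_) (sym (fromℕℚ-suc m))

poch-1≢0 : ∀ m → poch 1ℚ m ≢ 0ℚ
poch-1≢0 zero    = QP.1≢0
poch-1≢0 (suc m) = subst (_≢ 0ℚ) (sym (poch-1-suc m)) (*-≢0 (poch-1≢0 m) (fromℕℚ-suc≢0 m))

powℚ-1 : ∀ m → powℚ 1ℚ m ≡ 1ℚ
powℚ-1 zero    = refl
powℚ-1 (suc m) = trans (cong (_* 1ℚ) (powℚ-1 m)) refl

poch-neg : ∀ i m → poch (- fromℕℚ i) m ≡ sign m * (poch 1ℚ m * binom i m)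
poch-neg i zero    = refl
poch-neg i (suc m) = begin
  poch (- fromℕℚ i) m * (- fromℕℚ i + fromℕℚ m)
    ≡⟨ cong (_* (- fromℕℚ i + fromℕℚ m)) (poch-neg i m) ⟩
  (sign m * (poch 1ℚ m * binom i m)) * (- fromℕℚ i + fromℕℚ m)
    ≡⟨ solve 5 (λ s p c I M → (s :* (p :* c)) :* (:- I :+ M) := (:- s) :* (p :* ((I :- M) :* c))) refl
               (sign m) (poch 1ℚ m) (binom i m) (fromℕℚ i) (fromℕℚ m) ⟩
  (- sign m) * (poch 1ℚ m * ((fromℕℚ i - fromℕℚ m) * binom i m))
    ≡⟨ cong (λ c → (- sign m) * (poch 1ℚ m * c)) (binom-absorption i m) ⟨
  (- sign m) * (poch 1ℚ m * (fromℕℚ (suc m) * binom i (suc m)))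
    ≡⟨ cong ((- sign m) *_) (trans (sym (QP.*-assoc (poch 1ℚ m) _ _)) (cong (_* binom i (suc m)) (sym (poch-1-suc m)))) ⟩
  (- sign m) * (poch 1ℚ (suc m) * binom i (suc m)) ∎
  where open ≡-Reasoning

holmanWeight : ∀ n (i : Fin n) m → (poch (aSeq n i) m ÷' poch (ones n i) m) * powℚ (ones n i) m ≡ sign m * binom (toℕ i) m
holmanWeight n i m = trans
  (cong₂ _*_ (÷'-unique {r = sign m * binom (toℕ i) m} (poch-1≢0 m)
               (trans (solve 3 (λ s c p → (s :* c) :* p := s :* (p :* c)) refl (sign m) (binom (toℕ i) m) (poch 1ℚ m))
                      (sym (poch-neg (toℕ i) m))))
             (powℚ-1 m))
  (QP.*-identityʳ (sign m * binom (toℕ i) m))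

Δ-≢0 : ∀ n (Z : Fin n → ℚ) → (∀ i j → toℕ i ℕ.< toℕ j → Z i - Z j ≢ 0ℚ) → Δ n Z ≢ 0ℚ
Δ-≢0 zero    Z Z-distinct = QP.1≢0
Δ-≢0 (suc n) Z Z-distinct = *-≢0 (prodFin-≢0 n λ j → Z-distinct F.zero (F.suc j) (ℕ.s≤s ℕ.z≤n))
                                  (Δ-≢0 n (Z ∘ F.suc) λ i j i<j → Z-distinct (F.suc i) (F.suc j) (ℕ.s≤s i<j))

ratioAbove : ∀ {n} → (Fin n → ℚ) → (Fin n → ℚ) → Fin n → Fin n → ℚ
ratioAbove Y Z i j with toℕ i ℕ.<? toℕ j
... | yes _ = (Y i - Y j) ÷' (Z i - Z j)
... | no  _ = 1ℚ

ratioAbove-suc : ∀ {n} (Y Z : Fin (suc n) → ℚ) i j → ratioAbove Y Z (F.suc i) (F.suc j) ≡ ratioAbove (Y ∘ F.suc) (Z ∘ F.suc) i j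
ratioAbove-suc Y Z i j with suc (toℕ i) ℕ.<? suc (toℕ j) | toℕ i ℕ.<? toℕ j
... | yes _   | yes _   = refl
... | no  _   | no  _   = refl
... | yes 1+i<1+j | no i≮j = ⊥-elim (i≮j (NP.≤-pred 1+i<1+j))
... | no 1+i≮1+j  | yes i<j = ⊥-elim (1+i≮1+j (ℕ.s≤s i<j))

prodFin-ratioAbove : ∀ n (Y Z : Fin n → ℚ) → (∀ i j → toℕ i ℕ.< toℕ j → Z i - Z j ≢ 0ℚ) →
                     prodFin n (λ i → prodFin n (ratioAbove Y Z i)) ≡ Δ n Y ÷' Δ n Z
prodFin-ratioAbove zero    Y Z Z-distinct = sym 1÷'1≡1
prodFin-ratioAbove (suc n) Y Z Z-distinct = begin
  (1ℚ * prodFin n (λ j → (Y F.zero - Y (F.suc j)) ÷' (Z F.zero - Z (F.suc j))))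
    * prodFin n (λ i → 1ℚ * prodFin n (ratioAbove Y Z (F.suc i) ∘ F.suc))
    ≡⟨ cong₂ _*_ (trans (QP.*-identityˡ _) (prodFin-÷' n _ _ λ j → Z-distinct F.zero (F.suc j) (ℕ.s≤s ℕ.z≤n)))
                 (trans (prodFin-cong n λ i → trans (QP.*-identityˡ _) (prodFin-cong n (ratioAbove-suc Y Z i)))
                        (prodFin-ratioAbove n Y′ Z′ Z′-distinct)) ⟩
  (P Y ÷' P Z) * (Δ n Y′ ÷' Δ n Z′)
    ≡⟨ ÷'-*-÷' (P Y) (Δ n Y′) (prodFin-≢0 n λ j → Z-distinct F.zero (F.suc j) (ℕ.s≤s ℕ.z≤n)) (Δ-≢0 n Z′ Z′-distinct) ⟩
  Δ (suc n) Y ÷' Δ (suc n) Z ∎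
  where
  open ≡-Reasoning
  Y′ = Y ∘ F.suc
  Z′ = Z ∘ F.suc
  Z′-distinct : ∀ i j → toℕ i ℕ.< toℕ j → Z′ i - Z′ j ≢ 0ℚ
  Z′-distinct i j i<j = Z-distinct (F.suc i) (F.suc j) (ℕ.s≤s i<j)
  P : (Fin (suc n) → ℚ) → ℚ
  P W = prodFin n (λ j → W F.zero - W (F.suc j))

det-binomShift : ∀ n (s : Fin n → ℚ) (y : Fin n → ℕ) → det n (λ i j → s i * binomShift (toℕ i) (y i) (toℕ j)) ≡ prodFin n s
det-binomShift zero    s y = refl
det-binomShift (suc n) s y = begin
  det (suc n) M
    ≡⟨ det-firstColumnSingleton n M F.zero (λ { F.zero 0≢0 → ⊥-elim (0≢0 refl) ; (F.suc i) _ → QP.*-zeroʳ (s (F.suc i)) }) ⟩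
  1ℚ * ((s F.zero * 1ℚ) * det n (minor F.zero M))
    ≡⟨ cong (λ d → 1ℚ * ((s F.zero * 1ℚ) * d)) (det-binomShift n (s ∘ F.suc) (y ∘ F.suc)) ⟩
  1ℚ * ((s F.zero * 1ℚ) * prodFin n (s ∘ F.suc))
    ≡⟨ solve 2 (λ a p → con 1ℚ :* ((a :* con 1ℚ) :* p) := a :* p) refl (s F.zero) (prodFin n (s ∘ F.suc)) ⟩
  prodFin (suc n) s ∎
  where
  open ≡-Reasoning
  M : Matrix (suc n)
  M i j = s i * binomShift (toℕ i) (y i) (toℕ j)

∑Box-alternatingDet : ∀ n N (ℓ : Fin n → ℕ) → (∀ (i : Fin n) → toℕ i ℕ.≤ N) →
  ∑Box (λ _ → N) (λ u → det n λ i j → (sign (point u i) * binom (toℕ i) (point u i)) * binom (ℓ i ℕ.+ point u i) (toℕ j)) ≡ σ n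
∑Box-alternatingDet n N ℓ i≤N = begin
  ∑Box (λ _ → N) (λ u → det n λ i j → v i (coord u i) j)
    ≡⟨ multilinear-∑Box (det-multilinear n) (λ _ → N) v ⟩
  det n (λ i j → sum λ a → v i a j)
    ≡⟨ det-cong n (λ i j → rowSum i j) ⟩
  det n (λ i j → sign (toℕ i) * binomShift (toℕ i) (ℓ i) (toℕ j))
    ≡⟨ det-binomShift n (sign ∘ toℕ) ℓ ⟩
  prodFin n (sign ∘ toℕ)
    ≡⟨ σ≡prodFin-sign n ⟨
  σ n ∎
  where
  open ≡-Reasoning
  v : (i : Fin n) → Fin (suc N) → Fin n → ℚ
  v i a j = (sign (toℕ a) * binom (toℕ i) (toℕ a)) * binom (ℓ i ℕ.+ toℕ a) (toℕ j)
  rowSum : ∀ i j → sum (λ a → v i a j) ≡ sign (toℕ i) * binomShift (toℕ i) (ℓ i) (toℕ j)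
  rowSum i j = begin
    sum (λ a → v i a j)
      ≡⟨ sumTo≡sum N (λ t → (sign t * binom (toℕ i) t) * binom (ℓ i ℕ.+ t) (toℕ j)) ⟨
    sumTo N (λ t → (sign t * binom (toℕ i) t) * binom (ℓ i ℕ.+ t) (toℕ j))
      ≡⟨ sumTo-cong N (λ t → QP.*-assoc (sign t) _ _) ⟩
    altBinomSum (toℕ i) N (λ t → binom (ℓ i ℕ.+ t) (toℕ j))
      ≡⟨ altBinomSum-binom (toℕ i) N (ℓ i) (toℕ j) (i≤N i) ⟩
    sign (toℕ i) * binomShift (toℕ i) (ℓ i) (toℕ j) ∎

shiftedParts : (n : ℕ) → (Fin n → ℕ) → Fin n → ℕ
shiftedParts n μ i = μ i ℕ.+ (n ℕ.∸ suc (toℕ i))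

shiftedParts-decreasing : ∀ n (μ : Fin n → ℕ) → IsPartition n μ → ∀ i j → toℕ i ℕ.< toℕ j →
                          shiftedParts n μ j ℕ.< shiftedParts n μ i
shiftedParts-decreasing n μ μ-partition i j i<j =
  NP.≤-<-trans (NP.+-monoˡ-≤ _ (μ-partition i j (NP.<⇒≤ i<j)))
               (NP.+-monoʳ-< (μ i) (NP.∸-monoʳ-< (ℕ.s≤s i<j) (FP.toℕ<n j)))

fromℕℚ-shiftedParts : ∀ n μ i → fromℕℚ (shiftedParts n μ i) ≡ (fromℕℚ (μ i) + fromℕℚ n) - (1ℚ + fromℕℚ (toℕ i))
fromℕℚ-shiftedParts n μ i = begin
  ℓᵢ                                              ≡⟨ solve 2 (λ x y → x := (x :+ y) :- y) refl ℓᵢ (fromℕℚ (suc (toℕ i))) ⟩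
  (ℓᵢ + fromℕℚ (suc (toℕ i))) - fromℕℚ (suc (toℕ i))
    ≡⟨ cong₂ _-_ (trans (sym (fromℕℚ-+ (shiftedParts n μ i) (suc (toℕ i)))) (trans (cong fromℕℚ sum≡) (fromℕℚ-+ (μ i) n)))
                 (fromℕℚ-suc (toℕ i)) ⟩
  (fromℕℚ (μ i) + fromℕℚ n) - (1ℚ + fromℕℚ (toℕ i)) ∎
  where
  open ≡-Reasoning
  ℓᵢ = fromℕℚ (shiftedParts n μ i)
  sum≡ : shiftedParts n μ i ℕ.+ suc (toℕ i) ≡ μ i ℕ.+ n
  sum≡ = trans (NP.+-assoc (μ i) _ _) (cong (μ i ℕ.+_) (NP.m∸n+n≡m (FP.toℕ<n i)))

Aμ≡shiftedParts-difference : ∀ n μ i j → Aμ n μ i j ≡ fromℕℚ (shiftedParts n μ i) - fromℕℚ (shiftedParts n μ j)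
Aμ≡shiftedParts-difference n μ i j = sym (trans (cong₂ _-_ (fromℕℚ-shiftedParts n μ i) (fromℕℚ-shiftedParts n μ j))
  (solve 5 (λ a b N I J → ((a :+ N) :- (con 1ℚ :+ I)) :- ((b :+ N) :- (con 1ℚ :+ J)) := ((a :- b) :+ J) :- I)
           refl (fromℕℚ (μ i)) (fromℕℚ (μ j)) (fromℕℚ n) (fromℕℚ (toℕ i)) (fromℕℚ (toℕ j))))

module HolmanEvaluation (n : ℕ) (μ : Fin n → ℕ) (μ-partition : IsPartition n μ) where
  ℓ : Fin n → ℕ
  ℓ = shiftedParts n μ

  L : Fin n → ℚ
  L = fromℕℚ ∘ ℓ

  L-distinct : ∀ i j → toℕ i ℕ.< toℕ j → L i - L j ≢ 0ℚ
  L-distinct i j i<j = fromℕℚ-difference≢0 λ e → NP.<-irrefl (sym e) (shiftedParts-decreasing n μ μ-partition i j i<j)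

  ΔL≢0 : Δ n L ≢ 0ℚ
  ΔL≢0 = Δ-≢0 n L L-distinct

  term : (Fin n → ℕ) → ℚ
  term = holmanTerm n (Aμ n μ) (aSeq n) (ones n) (ones n)

  weight : (Fin n → ℕ) → ℚ
  weight k = prodFin n (λ i → sign (k i) * binom (toℕ i) (k i))

  mutual
    term≡Δ-ratio : ∀ k → term k ≡ (Δ n (λ i → fromℕℚ (ℓ i ℕ.+ k i)) ÷' Δ n L) * weight k
    term≡Δ-ratio k = cong₂ _*_
      (trans (prodFin-cong n λ i → prodFin-cong n (pairFactor≡ratioAbove k i))
             (prodFin-ratioAbove n (λ i → fromℕℚ (ℓ i ℕ.+ k i)) L L-distinct))
      (prodFin-cong n λ i → holmanWeight n i (k i))

    -- The left-hand side is the pairFactor local to holmanTerm, which cannot be named here.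
    pairFactor≡ratioAbove : ∀ (k : Fin n → ℕ) (i j : Fin n) → _
    pairFactor≡ratioAbove k i j with toℕ i ℕ.<? toℕ j
    ... | yes _ = cong₂ _÷'_
      (trans (cong (λ a → a + fromℕℚ (k i) - fromℕℚ (k j)) (Aμ≡shiftedParts-difference n μ i j))
        (trans (solve 4 (λ a b c d → (a :- b) :+ c :- d := (a :+ c) :- (b :+ d)) refl (L i) (L j) (fromℕℚ (k i)) (fromℕℚ (k j)))
               (sym (cong₂ _-_ (fromℕℚ-+ (ℓ i) (k i)) (fromℕℚ-+ (ℓ j) (k j))))))
      (Aμ≡shiftedParts-difference n μ i j)
    ... | no _ = refl

  term-cong : ∀ k k′ → (∀ i → k i ≡ k′ i) → term k ≡ term k′
  term-cong k k′ k≗k′ = trans (term≡Δ-ratio k) (trans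
    (cong₂ (λ D w → (D ÷' Δ n L) * w) (Δ-cong n λ i → cong (λ m → fromℕℚ (ℓ i ℕ.+ m)) (k≗k′ i))
                                       (prodFin-cong n λ i → cong (λ m → sign m * binom (toℕ i) m) (k≗k′ i)))
    (sym (term≡Δ-ratio k′)))

  Δ*weight≡det : ∀ k → Δ n (λ i → fromℕℚ (ℓ i ℕ.+ k i)) * weight k ≡
                 (σ n * superfactorial n) * det n (λ i j → (sign (k i) * binom (toℕ i) (k i)) * binom (ℓ i ℕ.+ k i) (toℕ j))
  Δ*weight≡det k = begin
    Δ n (fromℕℚ ∘ y) * weight k
      ≡⟨ cong (_* weight k) (begin
           Δ n (fromℕℚ ∘ y)                          ≡⟨ QP.*-identityˡ _ ⟨
           1ℚ * Δ n (fromℕℚ ∘ y)                      ≡⟨ cong (_* Δ n (fromℕℚ ∘ y)) (σ²≡1 n) ⟨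
           (σ n * σ n) * Δ n (fromℕℚ ∘ y)              ≡⟨ QP.*-assoc (σ n) (σ n) _ ⟩
           σ n * (σ n * Δ n (fromℕℚ ∘ y))              ≡⟨ cong (σ n *_) (vandermonde n y) ⟨
           σ n * (superfactorial n * binomDet n y)     ∎) ⟩
    (σ n * (superfactorial n * binomDet n y)) * weight k
      ≡⟨ solve 4 (λ s f w p → (s :* (f :* w)) :* p := (s :* f) :* (p :* w)) refl (σ n) (superfactorial n) (binomDet n y) (weight k) ⟩
    (σ n * superfactorial n) * (weight k * binomDet n y)
      ≡⟨ cong ((σ n * superfactorial n) *_) (det-scaleRows n (λ i → sign (k i) * binom (toℕ i) (k i)) (λ i j → binom (y i) (toℕ j))) ⟨
    (σ n * superfactorial n) * det n (λ i j → (sign (k i) * binom (toℕ i) (k i)) * binom (ℓ i ℕ.+ k i) (toℕ j)) ∎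
    where
    open ≡-Reasoning
    y : Fin n → ℕ
    y i = ℓ i ℕ.+ k i

  holmanPartial≡superfactorial÷Δ : ∀ N → n ℕ.≤ N → holmanPartial n (Aμ n μ) (aSeq n) (ones n) (ones n) N ≡ (1ℚ ÷' Δ n L) * superfactorial n
  holmanPartial≡superfactorial÷Δ N n≤N = begin
    boxSum n N term
      ≡⟨ boxSum≡∑Box n N term term-cong ⟩
    ∑Box cube (term ∘ point)
      ≡⟨ ∑Box-cong cube (λ u → trans (term≡Δ-ratio (point u)) (factor (point u))) ⟩
    ∑Box cube (λ u → (1ℚ ÷' Δ n L) * (Δ n (λ i → fromℕℚ (ℓ i ℕ.+ point u i)) * weight (point u)))
      ≡⟨ ∑Box-*ˡ cube (1ℚ ÷' Δ n L) _ ⟨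
    (1ℚ ÷' Δ n L) * ∑Box cube (λ u → Δ n (λ i → fromℕℚ (ℓ i ℕ.+ point u i)) * weight (point u))
      ≡⟨ cong ((1ℚ ÷' Δ n L) *_) (trans (∑Box-cong cube (Δ*weight≡det ∘ point)) (sym (∑Box-*ˡ cube (σ n * superfactorial n) _))) ⟩
    (1ℚ ÷' Δ n L) * ((σ n * superfactorial n) * ∑Box cube (λ u → det n λ i j → (sign (point u i) * binom (toℕ i) (point u i)) * binom (ℓ i ℕ.+ point u i) (toℕ j)))
      ≡⟨ cong (λ x → (1ℚ ÷' Δ n L) * ((σ n * superfactorial n) * x))
              (∑Box-alternatingDet n N ℓ (λ i → NP.<⇒≤ (NP.<-≤-trans (FP.toℕ<n i) n≤N))) ⟩
    (1ℚ ÷' Δ n L) * ((σ n * superfactorial n) * σ n)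
      ≡⟨ cong ((1ℚ ÷' Δ n L) *_) (trans (solve 2 (λ s f → (s :* f) :* s := (s :* s) :* f) refl (σ n) (superfactorial n))
                                         (trans (cong (_* superfactorial n) (σ²≡1 n)) (QP.*-identityˡ _))) ⟩
    (1ℚ ÷' Δ n L) * superfactorial n ∎
    where
    open ≡-Reasoning
    cube : Fin n → ℕ
    cube _ = N
    factor : ∀ k → (Δ n (λ i → fromℕℚ (ℓ i ℕ.+ k i)) ÷' Δ n L) * weight k ≡ (1ℚ ÷' Δ n L) * (Δ n (λ i → fromℕℚ (ℓ i ℕ.+ k i)) * weight k)
    factor k = trans (cong (_* weight k) (÷'≡*1÷' _ ΔL≢0))
                     (solve 3 (λ a b c → (a :* b) :* c := b :* (a :* c)) refl (Δ n (λ i → fromℕℚ (ℓ i ℕ.+ k i))) (1ℚ ÷' Δ n L) (weight k))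

  -- By vandermonde the hypothesis says c = Δ(ℓ)/sf(n).
  holmanPartial≡1÷'count : ∀ c → fromℕℚ c ≡ σ n * binomDet n ℓ → ∀ N → n ℕ.≤ N →
                      holmanPartial n (Aμ n μ) (aSeq n) (ones n) (ones n) N ≡ 1ℚ ÷' fromℕℚ c
  holmanPartial≡1÷'count c c≡ N n≤N = trans (holmanPartial≡superfactorial÷Δ N n≤N) (sym (÷'-unique c≢0 (begin
    ((1ℚ ÷' Δ n L) * superfactorial n) * fromℕℚ c  ≡⟨ QP.*-assoc (1ℚ ÷' Δ n L) _ _ ⟩
    (1ℚ ÷' Δ n L) * (superfactorial n * fromℕℚ c)  ≡⟨ cong ((1ℚ ÷' Δ n L) *_) sf*c≡ΔL ⟩
    (1ℚ ÷' Δ n L) * Δ n L                          ≡⟨ ÷'-*-cancel 1ℚ ΔL≢0 ⟩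
    1ℚ                                             ∎)))
    where
    open ≡-Reasoning
    sf*c≡ΔL : superfactorial n * fromℕℚ c ≡ Δ n L
    sf*c≡ΔL = begin
      superfactorial n * fromℕℚ c                  ≡⟨ cong (superfactorial n *_) c≡ ⟩
      superfactorial n * (σ n * binomDet n ℓ)      ≡⟨ solve 3 (λ f s w → f :* (s :* w) := s :* (f :* w)) refl (superfactorial n) (σ n) (binomDet n ℓ) ⟩
      σ n * (superfactorial n * binomDet n ℓ)      ≡⟨ cong (σ n *_) (vandermonde n ℓ) ⟩
      σ n * (σ n * Δ n L)                          ≡⟨ trans (sym (QP.*-assoc (σ n) (σ n) _)) (trans (cong (_* Δ n L) (σ²≡1 n)) (QP.*-identityˡ _)) ⟩
      Δ n L                                        ∎
    c≢0 : fromℕℚ c ≢ 0ℚ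
    c≢0 c≡0 = ΔL≢0 (trans (sym sf*c≡ΔL) (trans (cong (superfactorial n *_) c≡0) (QP.*-zeroʳ (superfactorial n))))

-- Counting semistandard tableaux

HasCard : (A : Set) → (A → A → Set) → ℕ → Set
HasCard A _≈_ c = Σ (Fin c → A) λ e → (∀ a → ∃ λ k → e k ≈ a) × (∀ k k′ → e k ≈ e k′ → k ≡ k′)

HasCard-transfer : ∀ {A B : Set} {_≈ᴬ_ : A → A → Set} {_≈ᴮ_ : B → B → Set} {c} →
                   IsEquivalence _≈ᴬ_ → IsEquivalence _≈ᴮ_ → (f : A → B) (g : B → A) →
                   (∀ {a a′} → a ≈ᴬ a′ → f a ≈ᴮ f a′) → (∀ {b b′} → b ≈ᴮ b′ → g b ≈ᴬ g b′) →
                   (∀ a → g (f a) ≈ᴬ a) → (∀ b → f (g b) ≈ᴮ b) → HasCard A _≈ᴬ_ c → HasCard B _≈ᴮ_ c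
HasCard-transfer ≈ᴬ-equiv ≈ᴮ-equiv f g f-resp g-resp gf≈ fg≈ (e , onto , injective) =
  f ∘ e ,
  (λ b → proj₁ (onto (g b)) , B.trans (f-resp (proj₂ (onto (g b)))) (fg≈ b)) ,
  (λ k k′ fe≈fe′ → injective k k′ (A.trans (A.sym (gf≈ (e k))) (A.trans (g-resp fe≈fe′) (gf≈ (e k′)))))
  where
  module A = IsEquivalence ≈ᴬ-equiv
  module B = IsEquivalence ≈ᴮ-equiv

ΣRel : ∀ {I : Set} (B : I → Set) → (∀ k → B k → B k → Set) → Σ I B → Σ I B → Set
ΣRel B R (k , b) (k′ , b′) = Σ (k ≡ k′) λ e → R k′ (subst B e b) b′

ΣRel-isEquivalence : ∀ {I : Set} (B : I → Set) (R : ∀ k → B k → B k → Set) → (∀ k → IsEquivalence (R k)) →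
                     IsEquivalence (ΣRel B R)
ΣRel-isEquivalence B R R-equiv = record
  { refl  = λ { {k , b} → refl , IsEquivalence.refl (R-equiv k) }
  ; sym   = λ { {k , b} (refl , r) → refl , IsEquivalence.sym (R-equiv k) r }
  ; trans = λ { {k , b} (refl , r) (refl , r′) → refl , IsEquivalence.trans (R-equiv k) r r′ }
  }

HasCard-ΣFin : ∀ m (B : Fin m → Set) (R : ∀ k → B k → B k → Set) (c : Fin m → ℕ) →
               (∀ k → HasCard (B k) (R k) (c k)) → HasCard (Σ (Fin m) B) (ΣRel B R) (sumℕ c)
HasCard-ΣFin zero    B R c cards = (λ ()) , (λ { (() , _) }) , (λ ())
HasCard-ΣFin (suc m) B R c cards = e ∘ F.splitAt c₀ , onto , injective
  where
  c₀ = c F.zero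
  rest = HasCard-ΣFin m (B ∘ F.suc) (R ∘ F.suc) (c ∘ F.suc) (cards ∘ F.suc)
  e₀ = proj₁ (cards F.zero)
  eᵣ = proj₁ rest
  e : Fin c₀ ⊎ Fin (sumℕ (c ∘ F.suc)) → Σ (Fin (suc m)) B
  e (inj₁ a) = F.zero , e₀ a
  e (inj₂ b) = F.suc (proj₁ (eᵣ b)) , proj₂ (eᵣ b)
  lift : ∀ {k k′} (k≡k′ : k ≡ k′) y x → R (F.suc k′) (subst (B ∘ F.suc) k≡k′ y) x → R (F.suc k′) (subst B (cong F.suc k≡k′) y) x
  lift refl y x r = r
  lower : ∀ {k k′} y y′ (e : F.suc k ≡ F.suc k′) → R (F.suc k′) (subst B e y) y′ → ΣRel (B ∘ F.suc) (R ∘ F.suc) (k , y) (k′ , y′)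
  lower y y′ refl r = refl , r
  onto : ∀ a → ∃ λ k → ΣRel B R (e (F.splitAt c₀ k)) a
  onto (F.zero , x) with proj₁ (proj₂ (cards F.zero)) x
  ... | a , r = a F.↑ˡ _ , subst (λ s → ΣRel B R (e s) (F.zero , x)) (sym (FP.splitAt-↑ˡ c₀ a _)) (refl , r)
  onto (F.suc k , x) with proj₁ (proj₂ rest) (k , x)
  ... | b , (k≡ , r) = c₀ F.↑ʳ b , subst (λ s → ΣRel B R (e s) (F.suc k , x)) (sym (FP.splitAt-↑ʳ c₀ _ b)) (cong F.suc k≡ , lift k≡ _ x r)
  e-injective : ∀ s s′ → ΣRel B R (e s) (e s′) → s ≡ s′
  e-injective (inj₁ a) (inj₁ a′) (refl , r) = cong inj₁ (proj₂ (proj₂ (cards F.zero)) a a′ r)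
  e-injective (inj₁ a) (inj₂ b)  (() , _)
  e-injective (inj₂ b) (inj₁ a)  (() , _)
  e-injective (inj₂ b) (inj₂ b′) (k≡ , r) = cong inj₂ (proj₂ (proj₂ rest) b b′ (lower (proj₂ (eᵣ b)) (proj₂ (eᵣ b′)) k≡ r))
  injective : ∀ k k′ → ΣRel B R (e (F.splitAt c₀ k)) (e (F.splitAt c₀ k′)) → k ≡ k′
  injective k k′ r = trans (sym (FP.join-splitAt c₀ _ k))
                           (trans (cong (F.join c₀ _) (e-injective (F.splitAt c₀ k) (F.splitAt c₀ k′) r)) (FP.join-splitAt c₀ _ k′))

∑Boxℕ : ∀ {n} d → (Box n d → ℕ) → ℕ
∑Boxℕ {zero}  d c = c tt
∑Boxℕ {suc n} d c = sumℕ λ a → ∑Boxℕ (d ∘ F.suc) (λ u → c (a , u))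

fromℕℚ-sumℕ : ∀ {m} (c : Fin m → ℕ) → fromℕℚ (sumℕ c) ≡ sum (fromℕℚ ∘ c)
fromℕℚ-sumℕ {zero}  c = refl
fromℕℚ-sumℕ {suc m} c = trans (fromℕℚ-+ (c F.zero) _) (cong (fromℕℚ (c F.zero) +_) (fromℕℚ-sumℕ (c ∘ F.suc)))

fromℕℚ-∑Boxℕ : ∀ {n} d (c : Box n d → ℕ) → fromℕℚ (∑Boxℕ d c) ≡ ∑Box d (fromℕℚ ∘ c)
fromℕℚ-∑Boxℕ {zero}  d c = refl
fromℕℚ-∑Boxℕ {suc n} d c = trans (fromℕℚ-sumℕ (λ a → ∑Boxℕ (d ∘ F.suc) (λ u → c (a , u))))
                                 (sum-cong-≗ λ a → fromℕℚ-∑Boxℕ (d ∘ F.suc) (λ u → c (a , u)))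

HasCard-ΣBox : ∀ {n} d (B : Box n d → Set) (R : ∀ u → B u → B u → Set) → (∀ u → IsEquivalence (R u)) → (c : Box n d → ℕ) →
               (∀ u → HasCard (B u) (R u) (c u)) → HasCard (Σ (Box n d) B) (ΣRel B R) (∑Boxℕ d c)
HasCard-ΣBox {zero} d B R R-equiv c cards with cards tt
... | e , onto , injective = (λ k → tt , e k) , (λ { (tt , b) → proj₁ (onto b) , refl , proj₂ (onto b) }) ,
                             (λ { k k′ (refl , r) → injective k k′ r })
HasCard-ΣBox {suc n} d B R R-equiv c cards =
  HasCard-transfer (ΣRel-isEquivalence B′ R′ λ a → ΣRel-isEquivalence (B ∘ (a ,_)) (R ∘ (a ,_)) (R-equiv ∘ (a ,_)))
                   (ΣRel-isEquivalence B R R-equiv)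
                   assoc unassoc assoc-resp unassoc-resp
                   (λ { (a , u , b) → refl , refl , IsEquivalence.refl (R-equiv (a , u)) })
                   (λ { ((a , u) , b) → refl , IsEquivalence.refl (R-equiv (a , u)) })
                   (HasCard-ΣFin (suc (d F.zero)) B′ R′ (λ a → ∑Boxℕ (d ∘ F.suc) (c ∘ (a ,_)))
                      λ a → HasCard-ΣBox (d ∘ F.suc) (B ∘ (a ,_)) (R ∘ (a ,_)) (R-equiv ∘ (a ,_)) (c ∘ (a ,_)) (cards ∘ (a ,_)))
  where
  B′ : Fin (suc (d F.zero)) → Set
  B′ a = Σ (Box n (d ∘ F.suc)) (B ∘ (a ,_))
  R′ : ∀ a → B′ a → B′ a → Set
  R′ a = ΣRel (B ∘ (a ,_)) (R ∘ (a ,_))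
  assoc : Σ (Fin (suc (d F.zero))) B′ → Σ (Box (suc n) d) B
  assoc (a , u , b) = (a , u) , b
  unassoc : Σ (Box (suc n) d) B → Σ (Fin (suc (d F.zero))) B′
  unassoc ((a , u) , b) = a , u , b
  assoc-resp : ∀ {x y} → ΣRel B′ R′ x y → ΣRel B R (assoc x) (assoc y)
  assoc-resp {a , u , b} {.a , .u , b′} (refl , refl , r) = refl , r
  unassoc-resp : ∀ {x y} → ΣRel B R x y → ΣRel B′ R′ (unassoc x) (unassoc y)
  unassoc-resp {(a , u) , b} {.(a , u) , b′} (refl , r) = refl , refl , r

indicator : ∀ {P : Set} → Dec P → ℕ
indicator (yes _) = 1
indicator (no  _) = 0

countBelow : ∀ {N} (th m : ℕ) → (Fin m → Fin N) → ℕ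
countBelow th zero    f = 0
countBelow th (suc m) f = indicator (toℕ (f F.zero) ℕ.<? th) ℕ.+ countBelow th m (f ∘ F.suc)

WeaklyIncreasing : ∀ {N} m → (Fin m → Fin N) → Set
WeaklyIncreasing m f = ∀ (j j′ : Fin m) → toℕ j ℕ.≤ toℕ j′ → toℕ (f j) ℕ.≤ toℕ (f j′)

countBelow-cong : ∀ {N} th m (f f′ : Fin m → Fin N) → (∀ j → f j ≡ f′ j) → countBelow th m f ≡ countBelow th m f′
countBelow-cong th zero    f f′ f≗f′ = refl
countBelow-cong th (suc m) f f′ f≗f′ =
  cong₂ ℕ._+_ (cong (λ x → indicator (toℕ x ℕ.<? th)) (f≗f′ F.zero)) (countBelow-cong th m _ _ (f≗f′ ∘ F.suc))

countBelow-none : ∀ {N} th m (f : Fin m → Fin N) → (∀ j → ¬ (toℕ (f j) ℕ.< th)) → countBelow th m f ≡ 0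
countBelow-none th zero    f none = refl
countBelow-none th (suc m) f none = trans (cong (ℕ._+ countBelow th m (f ∘ F.suc)) (first (toℕ (f F.zero) ℕ.<? th)))
                                          (countBelow-none th m _ (none ∘ F.suc))
  where
  first : (d : Dec (toℕ (f F.zero) ℕ.< th)) → indicator d ≡ 0
  first (yes f₀<th) = ⊥-elim (none F.zero f₀<th)
  first (no  _)     = refl

countBelow-≤ : ∀ {N} th m (f : Fin m → Fin N) → countBelow th m f ℕ.≤ m
countBelow-≤ th zero    f = ℕ.z≤n
countBelow-≤ th (suc m) f = first (toℕ (f F.zero) ℕ.<? th)
  where
  first : (d : Dec (toℕ (f F.zero) ℕ.< th)) → indicator d ℕ.+ countBelow th m (f ∘ F.suc) ℕ.≤ suc m
  first (yes _) = ℕ.s≤s (countBelow-≤ th m _)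
  first (no  _) = NP.m≤n⇒m≤1+n (countBelow-≤ th m _)

countBelow-prefix : ∀ {N} th m (f : Fin m → Fin N) → WeaklyIncreasing m f → ∀ j →
                    (toℕ (f j) ℕ.< th → toℕ j ℕ.< countBelow th m f) × (toℕ j ℕ.< countBelow th m f → toℕ (f j) ℕ.< th)
countBelow-prefix th (suc m) f f-incr j = first (toℕ (f F.zero) ℕ.<? th) j
  where
  tail-incr : WeaklyIncreasing m (f ∘ F.suc)
  tail-incr a b a≤b = f-incr (F.suc a) (F.suc b) (ℕ.s≤s a≤b)
  first : (d : Dec (toℕ (f F.zero) ℕ.< th)) → ∀ j →
          (toℕ (f j) ℕ.< th → toℕ j ℕ.< indicator d ℕ.+ countBelow th m (f ∘ F.suc)) ×
          (toℕ j ℕ.< indicator d ℕ.+ countBelow th m (f ∘ F.suc) → toℕ (f j) ℕ.< th)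
  first (yes f₀<th) F.zero    = (λ _ → ℕ.s≤s ℕ.z≤n) , (λ _ → f₀<th)
  first (yes f₀<th) (F.suc j) = (λ fj<th → ℕ.s≤s (proj₁ (countBelow-prefix th m _ tail-incr j) fj<th)) ,
                                (λ j<c → proj₂ (countBelow-prefix th m _ tail-incr j) (NP.≤-pred j<c))
  first (no f₀≮th) j = (λ fj<th → ⊥-elim (f₀≮th (NP.≤-<-trans (f-incr F.zero j ℕ.z≤n) fj<th))) ,
                       (λ j<c → ⊥-elim (NP.n≮0 (subst (toℕ j ℕ.<_) (countBelow-none th m _ λ j′ fj′<th →
                                                  f₀≮th (NP.≤-<-trans (f-incr F.zero (F.suc j′) ℕ.z≤n) fj′<th)) j<c)))

countBelow-≥ : ∀ {N} th m (f : Fin m → Fin N) → WeaklyIncreasing m f → ∀ a → a ℕ.≤ m →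
               (∀ (j : Fin m) → toℕ j ℕ.< a → toℕ (f j) ℕ.< th) → a ℕ.≤ countBelow th m f
countBelow-≥ th m f f-incr a a≤m below with a ℕ.≤? countBelow th m f
... | yes a≤c = a≤c
... | no  a≰c = ⊥-elim (NP.<-irrefl refl (subst (ℕ._< countBelow th m f) (FP.toℕ-fromℕ< c<m)
                  (proj₁ (countBelow-prefix th m f f-incr j) (below j (subst (ℕ._< a) (sym (FP.toℕ-fromℕ< c<m)) (NP.≰⇒> a≰c))))))
  where
  c<m : countBelow th m f ℕ.< m
  c<m = NP.<-≤-trans (NP.≰⇒> a≰c) a≤m
  j = F.fromℕ< c<m

countBelow-unique : ∀ {N} th m (f : Fin m → Fin N) a → a ℕ.≤ m →
                    (∀ j → (toℕ (f j) ℕ.< th → toℕ j ℕ.< a) × (toℕ j ℕ.< a → toℕ (f j) ℕ.< th)) → countBelow th m f ≡ a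
countBelow-unique th zero    f zero    _           _     = refl
countBelow-unique th (suc m) f zero    _           below = countBelow-none th (suc m) f (λ j fj<th → NP.n≮0 (proj₁ (below j) fj<th))
countBelow-unique th (suc m) f (suc a) (ℕ.s≤s a≤m) below = first (toℕ (f F.zero) ℕ.<? th)
  where
  first : (d : Dec (toℕ (f F.zero) ℕ.< th)) → indicator d ℕ.+ countBelow th m (f ∘ F.suc) ≡ suc a
  first (yes _)     = cong suc (countBelow-unique th m _ a a≤m λ j →
                        (λ fj<th → NP.≤-pred (proj₁ (below (F.suc j)) fj<th)) , (λ j<a → proj₂ (below (F.suc j)) (ℕ.s≤s j<a)))
  first (no f₀≮th) = ⊥-elim (f₀≮th (proj₂ (below F.zero) (ℕ.s≤s ℕ.z≤n)))

filling-cong : ∀ {m} {κ : Fin m → ℕ} (T : Filling m κ) {i i′} (j : Fin (κ i)) (j′ : Fin (κ i′)) →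
               i ≡ i′ → toℕ j ≡ toℕ j′ → T i j ≡ T i′ j′
filling-cong T j j′ refl j≡j′ = cong (T _) (FP.toℕ-injective j≡j′)

≈SST-isEquivalence : ∀ {m} {κ : Fin m → ℕ} → IsEquivalence (_≈SST_ {m} {κ})
≈SST-isEquivalence = record
  { refl  = λ i j → refl
  ; sym   = λ T≈T′ i j → sym (T≈T′ i j)
  ; trans = λ T≈T′ T′≈T″ i j → trans (T≈T′ i j) (T′≈T″ i j)
  }

SST-row≤entry : ∀ {m} (κ : Fin m → ℕ) → IsPartition m κ → (T : Filling m κ) → IsSST m κ T →
                ∀ k (i : Fin m) → toℕ i ≡ k → ∀ j → k ℕ.≤ toℕ (T i j)
SST-row≤entry κ κ-partition T T-sst zero    i i≡k j = ℕ.z≤n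
SST-row≤entry {m} κ κ-partition T T-sst (suc k) i i≡1+k j =
  NP.≤-<-trans (SST-row≤entry κ κ-partition T T-sst k i′ (FP.toℕ-fromℕ< k<m) j′) above<Tij
  where
  k<m : k ℕ.< m
  k<m = NP.<-trans (subst (k ℕ.<_) (sym i≡1+k) (NP.n<1+n k)) (FP.toℕ<n i)
  i′ = F.fromℕ< k<m
  i′<i : toℕ i′ ℕ.< toℕ i
  i′<i = subst₂ ℕ._<_ (sym (FP.toℕ-fromℕ< k<m)) (sym i≡1+k) (NP.n<1+n k)
  j′ : Fin (κ i′)
  j′ = F.fromℕ< (NP.<-≤-trans (FP.toℕ<n j) (κ-partition i′ i (NP.<⇒≤ i′<i)))
  above<Tij : toℕ (T i′ j′) ℕ.< toℕ (T i j)
  above<Tij = proj₂ T-sst i′ i i′<i j′ j (FP.toℕ-fromℕ< _)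

gaps : ∀ {n} → (Fin (suc n) → ℕ) → Fin n → ℕ
gaps μ i = μ (F.inject₁ i) ℕ.∸ μ (F.suc i)

-- the shapes with μ (i + 1) ≤ ν i ≤ μ i
interlacing : ∀ {n} (μ : Fin (suc n) → ℕ) → Box n (gaps μ) → Fin n → ℕ
interlacing μ u i = μ (F.suc i) ℕ.+ point u i

module Branching (n : ℕ) (μ : Fin (suc n) → ℕ) (μ-partition : IsPartition (suc n) μ) where
  top : Fin (suc n)
  top = F.fromℕ n

  toℕ-top : toℕ top ≡ n
  toℕ-top = FP.toℕ-fromℕ n

  toℕ≤n : ∀ (x : Fin (suc n)) → toℕ x ℕ.≤ n
  toℕ≤n x = NP.≤-pred (FP.toℕ<n x)

  ≮n⇒≡top : ∀ (x : Fin (suc n)) → ¬ (toℕ x ℕ.< n) → x ≡ top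
  ≮n⇒≡top x x≮n = FP.toℕ-injective (trans (NP.≤-antisym (toℕ≤n x) (NP.≮⇒≥ x≮n)) (sym toℕ-top))

  toℕ-inject₁<n : ∀ (i : Fin n) → toℕ (F.inject₁ i) ℕ.< n
  toℕ-inject₁<n i = subst (ℕ._< n) (sym (FP.toℕ-inject₁ i)) (FP.toℕ<n i)

  inject₁<suc : ∀ (i : Fin n) → toℕ (F.inject₁ i) ℕ.< suc (toℕ i)
  inject₁<suc i = ℕ.s≤s (NP.≤-reflexive (FP.toℕ-inject₁ i))

  μ-suc≤μ-inject₁ : ∀ i → μ (F.suc i) ℕ.≤ μ (F.inject₁ i)
  μ-suc≤μ-inject₁ i = μ-partition (F.inject₁ i) (F.suc i) (NP.<⇒≤ (inject₁<suc i))

  ν : Box n (gaps μ) → Fin n → ℕ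
  ν = interlacing μ

  ν≤μ : ∀ u i → ν u i ℕ.≤ μ (F.inject₁ i)
  ν≤μ u i = begin
    μ (F.suc i) ℕ.+ point u i  ≤⟨ NP.+-monoʳ-≤ (μ (F.suc i)) (NP.≤-pred (FP.toℕ<n (coord u i))) ⟩
    μ (F.suc i) ℕ.+ gaps μ i     ≡⟨ NP.m+[n∸m]≡n (μ-suc≤μ-inject₁ i) ⟩
    μ (F.inject₁ i)            ∎
    where open NP.≤-Reasoning

  ν-partition : ∀ u → IsPartition n (ν u)
  ν-partition u i j i≤j with toℕ i ℕ.≟ toℕ j
  ... | yes i≡j = subst (λ w → ν u w ℕ.≤ ν u i) (FP.toℕ-injective i≡j) NP.≤-refl
  ... | no  i≢j = begin
    ν u j              ≤⟨ ν≤μ u j ⟩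
    μ (F.inject₁ j)    ≤⟨ μ-partition (F.suc i) (F.inject₁ j) (subst (suc (toℕ i) ℕ.≤_) (sym (FP.toℕ-inject₁ j)) (NP.≤∧≢⇒< i≤j i≢j)) ⟩
    μ (F.suc i)        ≤⟨ NP.m≤m+n _ _ ⟩
    ν u i              ∎
    where open NP.≤-Reasoning

  Restricted : Box n (gaps μ) → Set
  Restricted u = SST n (ν u)

  _≈Σ_ : Σ (Box n (gaps μ)) Restricted → Σ (Box n (gaps μ)) Restricted → Set
  _≈Σ_ = ΣRel Restricted (λ _ → _≈SST_)

  -- Row i < n keeps its count(i) entries below n, the others being n; μ (i+1) ≤ count(i) by column strictness.
  module Forward (T : Filling (suc n) μ) (T-sst : IsSST (suc n) μ T) where
    row : Fin n → Fin (suc n)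
    row = F.inject₁

    count : Fin n → ℕ
    count i = countBelow n (μ (row i)) (T (row i))

    row-incr : ∀ i → WeaklyIncreasing (μ (row i)) (T (row i))
    row-incr i j j′ j≤j′ = proj₁ T-sst (row i) j j′ j≤j′

    count≤μ : ∀ i → count i ℕ.≤ μ (row i)
    count≤μ i = countBelow-≤ n _ _

    μ-suc≤count : ∀ i → μ (F.suc i) ℕ.≤ count i
    μ-suc≤count i = countBelow-≥ n _ _ (row-incr i) (μ (F.suc i)) (μ-suc≤μ-inject₁ i) λ j j<μ →
      NP.<-≤-trans (proj₂ T-sst (row i) (F.suc i) (inject₁<suc i) j (F.fromℕ< j<μ) (sym (FP.toℕ-fromℕ< j<μ))) (toℕ≤n _)

    shape : Box n (gaps μ)
    shape = tabulateBox (gaps μ) (λ i → F.fromℕ< (ℕ.s≤s (NP.∸-monoˡ-≤ (μ (F.suc i)) (count≤μ i))))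

    ν-shape : ∀ i → ν shape i ≡ count i
    ν-shape i = trans (cong (μ (F.suc i) ℕ.+_) (trans (cong toℕ (coord-tabulateBox (gaps μ) _ i)) (FP.toℕ-fromℕ< _)))
                      (NP.m+[n∸m]≡n (μ-suc≤count i))

    column : ∀ i (j : Fin (ν shape i)) → Fin (μ (row i))
    column i j = F.fromℕ< (NP.<-≤-trans (subst (toℕ j ℕ.<_) (ν-shape i) (FP.toℕ<n j)) (count≤μ i))

    toℕ-column : ∀ i j → toℕ (column i j) ≡ toℕ j
    toℕ-column i j = FP.toℕ-fromℕ< _

    entry<n : ∀ i (j : Fin (ν shape i)) → toℕ (T (row i) (column i j)) ℕ.< n
    entry<n i j = proj₂ (countBelow-prefix n _ _ (row-incr i) (column i j))
                        (subst₂ ℕ._<_ (sym (toℕ-column i j)) (ν-shape i) (FP.toℕ<n j))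

    restricted : Filling n (ν shape)
    restricted i j = F.fromℕ< (entry<n i j)

    toℕ-restricted : ∀ i j → toℕ (restricted i j) ≡ toℕ (T (row i) (column i j))
    toℕ-restricted i j = FP.toℕ-fromℕ< (entry<n i j)

    restricted-sst : IsSST n (ν shape) restricted
    restricted-sst =
      (λ i j j′ j≤j′ → subst₂ ℕ._≤_ (sym (toℕ-restricted i j)) (sym (toℕ-restricted i j′))
         (proj₁ T-sst (row i) (column i j) (column i j′) (subst₂ ℕ._≤_ (sym (toℕ-column i j)) (sym (toℕ-column i j′)) j≤j′))) ,
      (λ i i′ i<i′ j j′ j≡j′ → subst₂ ℕ._<_ (sym (toℕ-restricted i j)) (sym (toℕ-restricted i′ j′))
         (proj₂ T-sst (row i) (row i′) (subst₂ ℕ._<_ (sym (FP.toℕ-inject₁ i)) (sym (FP.toℕ-inject₁ i′)) i<i′) (column i j) (column i′ j′)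
            (trans (toℕ-column i j) (trans j≡j′ (sym (toℕ-column i′ j′))))))

    beyond≡top : ∀ i (j : Fin (μ (row i))) → ¬ (toℕ j ℕ.< count i) → T (row i) j ≡ top
    beyond≡top i j j≮count = ≮n⇒≡top _ (λ Tij<n → j≮count (proj₁ (countBelow-prefix n _ _ (row-incr i) j) Tij<n))

  forward : SST (suc n) μ → Σ (Box n (gaps μ)) Restricted
  forward (T , T-sst) = shape , restricted , restricted-sst
    where open Forward T T-sst

  extend : (u : Box n (gaps μ)) → Filling n (ν u) → Filling (suc n) μ
  extend u X i j with toℕ i ℕ.<? n
  ... | no  _   = top
  ... | yes i<n with toℕ j ℕ.<? ν u (F.fromℕ< i<n)
  ...   | yes j<ν = F.inject₁ (X (F.fromℕ< i<n) (F.fromℕ< j<ν))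
  ...   | no  _   = top

  extend-last : ∀ u X i j → ¬ (toℕ i ℕ.< n) → extend u X i j ≡ top
  extend-last u X i j i≮n with toℕ i ℕ.<? n
  ... | yes i<n = ⊥-elim (i≮n i<n)
  ... | no  _   = refl

  extend-inside : ∀ u X i j (i<n : toℕ i ℕ.< n) (j<ν : toℕ j ℕ.< ν u (F.fromℕ< i<n)) →
                  extend u X i j ≡ F.inject₁ (X (F.fromℕ< i<n) (F.fromℕ< j<ν))
  extend-inside u X i j i<n j<ν with toℕ i ℕ.<? n
  ... | no  i≮n  = ⊥-elim (i≮n i<n)
  ... | yes i<n′ with toℕ j ℕ.<? ν u (F.fromℕ< i<n′)
  ...   | yes _   = refl
  ...   | no  j≮ν = ⊥-elim (j≮ν j<ν)

  extend-outside : ∀ u X i j (i<n : toℕ i ℕ.< n) → ¬ (toℕ j ℕ.< ν u (F.fromℕ< i<n)) → extend u X i j ≡ top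
  extend-outside u X i j i<n j≮ν with toℕ i ℕ.<? n
  ... | no  _    = refl
  ... | yes i<n′ with toℕ j ℕ.<? ν u (F.fromℕ< i<n′)
  ...   | yes j<ν = ⊥-elim (j≮ν j<ν)
  ...   | no  _   = refl

  extend-rows : ∀ u X → IsSST n (ν u) X → ∀ i (j j′ : Fin (μ i)) → toℕ j ℕ.≤ toℕ j′ →
                toℕ (extend u X i j) ℕ.≤ toℕ (extend u X i j′)
  extend-rows u X X-sst i j j′ j≤j′ = byRow (toℕ i ℕ.<? n)
    where
    byRow : Dec (toℕ i ℕ.< n) → toℕ (extend u X i j) ℕ.≤ toℕ (extend u X i j′)
    byRow (no i≮n)  = NP.≤-reflexive (cong toℕ (trans (extend-last u X i j i≮n) (sym (extend-last u X i j′ i≮n))))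
    byRow (yes i<n) = byColumn (toℕ j′ ℕ.<? ν u (F.fromℕ< i<n))
      where
      byColumn : Dec (toℕ j′ ℕ.< ν u (F.fromℕ< i<n)) → toℕ (extend u X i j) ℕ.≤ toℕ (extend u X i j′)
      byColumn (no j′≮ν) = subst (λ w → toℕ (extend u X i j) ℕ.≤ toℕ w) (sym (extend-outside u X i j′ i<n j′≮ν))
                                 (subst (toℕ (extend u X i j) ℕ.≤_) (sym toℕ-top) (toℕ≤n _))
      byColumn (yes j′<ν) = subst₂ (λ a b → toℕ a ℕ.≤ toℕ b) (sym (extend-inside u X i j i<n j<ν)) (sym (extend-inside u X i j′ i<n j′<ν))
        (subst₂ ℕ._≤_ (sym (FP.toℕ-inject₁ _)) (sym (FP.toℕ-inject₁ _))
           (proj₁ X-sst (F.fromℕ< i<n) (F.fromℕ< j<ν) (F.fromℕ< j′<ν)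
              (subst₂ ℕ._≤_ (sym (FP.toℕ-fromℕ< j<ν)) (sym (FP.toℕ-fromℕ< j′<ν)) j≤j′)))
        where
        j<ν : toℕ j ℕ.< ν u (F.fromℕ< i<n)
        j<ν = NP.≤-<-trans j≤j′ j′<ν

  extend-columns : ∀ u X → IsSST n (ν u) X → ∀ i i′ → toℕ i ℕ.< toℕ i′ → (j : Fin (μ i)) (j′ : Fin (μ i′)) →
                   toℕ j ≡ toℕ j′ → toℕ (extend u X i j) ℕ.< toℕ (extend u X i′ j′)
  extend-columns u X X-sst i i′ i<i′ j j′ j≡j′ =
    subst (λ w → toℕ w ℕ.< toℕ (extend u X i′ j′)) (sym (extend-inside u X i j i<n j<ν)) (byRow (toℕ i′ ℕ.<? n))
    where
    i<n : toℕ i ℕ.< n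
    i<n = NP.<-≤-trans i<i′ (toℕ≤n i′)
    r = F.fromℕ< i<n
    j<ν : toℕ j ℕ.< ν u r
    j<ν = begin-strict
      toℕ j            ≡⟨ j≡j′ ⟩
      toℕ j′           <⟨ FP.toℕ<n j′ ⟩
      μ i′             ≤⟨ μ-partition (F.suc r) i′ (subst (λ w → suc w ℕ.≤ toℕ i′) (sym (FP.toℕ-fromℕ< i<n)) i<i′) ⟩
      μ (F.suc r)      ≤⟨ NP.m≤m+n _ _ ⟩
      ν u r            ∎
      where open NP.≤-Reasoning
    lower : toℕ (F.inject₁ (X r (F.fromℕ< j<ν))) ℕ.< n
    lower = subst (ℕ._< n) (sym (FP.toℕ-inject₁ _)) (FP.toℕ<n _)
    byRow : Dec (toℕ i′ ℕ.< n) → toℕ (F.inject₁ (X r (F.fromℕ< j<ν))) ℕ.< toℕ (extend u X i′ j′)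
    byRow (no i′≮n)  = subst (toℕ (F.inject₁ (X r (F.fromℕ< j<ν))) ℕ.<_) (sym (trans (cong toℕ (extend-last u X i′ j′ i′≮n)) toℕ-top)) lower
    byRow (yes i′<n) = byColumn (toℕ j′ ℕ.<? ν u (F.fromℕ< i′<n))
      where
      byColumn : Dec (toℕ j′ ℕ.< ν u (F.fromℕ< i′<n)) → toℕ (F.inject₁ (X r (F.fromℕ< j<ν))) ℕ.< toℕ (extend u X i′ j′)
      byColumn (no j′≮ν)  = subst (toℕ (F.inject₁ (X r (F.fromℕ< j<ν))) ℕ.<_) (sym (trans (cong toℕ (extend-outside u X i′ j′ i′<n j′≮ν)) toℕ-top)) lower
      byColumn (yes j′<ν) = subst₂ ℕ._<_ (sym (FP.toℕ-inject₁ _)) (sym (trans (cong toℕ (extend-inside u X i′ j′ i′<n j′<ν)) (FP.toℕ-inject₁ _)))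
        (proj₂ X-sst r (F.fromℕ< i′<n) (subst₂ ℕ._<_ (sym (FP.toℕ-fromℕ< i<n)) (sym (FP.toℕ-fromℕ< i′<n)) i<i′) (F.fromℕ< j<ν) (F.fromℕ< j′<ν)
           (trans (FP.toℕ-fromℕ< j<ν) (trans j≡j′ (sym (FP.toℕ-fromℕ< j′<ν)))))

  backward : Σ (Box n (gaps μ)) Restricted → SST (suc n) μ
  backward (u , X , X-sst) = extend u X , extend-rows u X X-sst , extend-columns u X X-sst

  backward-forward : ∀ T → backward (forward T) ≈SST T
  backward-forward (T , T-sst) i j = byRow (toℕ i ℕ.<? n)
    where
    open Forward T T-sst
    byRow : Dec (toℕ i ℕ.< n) → extend shape restricted i j ≡ T i j
    byRow (no i≮n)  = trans (extend-last shape restricted i j i≮n) (sym (≮n⇒≡top (T i j) λ Tij<n →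
                        i≮n (NP.≤-<-trans (SST-row≤entry μ μ-partition T T-sst (toℕ i) i refl j) Tij<n)))
    byRow (yes i<n) = byColumn (toℕ j ℕ.<? ν shape r)
      where
      r = F.fromℕ< i<n
      row-r : row r ≡ i
      row-r = FP.toℕ-injective (trans (FP.toℕ-inject₁ r) (FP.toℕ-fromℕ< i<n))
      byColumn : Dec (toℕ j ℕ.< ν shape r) → extend shape restricted i j ≡ T i j
      byColumn (yes j<ν) = trans (extend-inside shape restricted i j i<n j<ν) (FP.toℕ-injective (begin
        toℕ (F.inject₁ (restricted r (F.fromℕ< j<ν)))   ≡⟨ FP.toℕ-inject₁ _ ⟩
        toℕ (restricted r (F.fromℕ< j<ν))               ≡⟨ toℕ-restricted r (F.fromℕ< j<ν) ⟩
        toℕ (T (row r) (column r (F.fromℕ< j<ν)))        ≡⟨ cong toℕ (filling-cong T _ j row-r (trans (toℕ-column r _) (FP.toℕ-fromℕ< j<ν))) ⟩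
        toℕ (T i j)                                      ∎))
        where open ≡-Reasoning
      byColumn (no j≮ν) = trans (extend-outside shape restricted i j i<n j≮ν)
        (sym (trans (filling-cong T j j″ (sym row-r) (sym (FP.toℕ-fromℕ< _)))
                    (beyond≡top r j″ λ j″<count → j≮ν (subst₂ ℕ._<_ (FP.toℕ-fromℕ< _) (sym (ν-shape r)) j″<count))))
        where
        j″ : Fin (μ (row r))
        j″ = F.fromℕ< (subst (λ w → toℕ j ℕ.< μ w) (sym row-r) (FP.toℕ<n j))

  subst-≈SST : ∀ {u₁ u₂} (u₁≡u₂ : u₁ ≡ u₂) (Y : Restricted u₁) (Z : Restricted u₂) →
               (∀ i j₁ j₂ → toℕ j₁ ≡ toℕ j₂ → proj₁ Y i j₁ ≡ proj₁ Z i j₂) → subst Restricted u₁≡u₂ Y ≈SST Z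
  subst-≈SST refl Y Z Y≈Z i j = Y≈Z i j j refl

  forward-backward : ∀ x → forward (backward x) ≈Σ x
  forward-backward (u , X , X-sst) = shape≡u , subst-≈SST shape≡u (restricted , restricted-sst) (X , X-sst) entries
    where
    open Forward (extend u X) (proj₂ (backward (u , X , X-sst)))
    fromℕ<-inject₁ : ∀ (i : Fin n) → F.fromℕ< (toℕ-inject₁<n i) ≡ i
    fromℕ<-inject₁ i = FP.toℕ-injective (trans (FP.toℕ-fromℕ< (toℕ-inject₁<n i)) (FP.toℕ-inject₁ i))
    below⇔ : ∀ i (j : Fin (μ (row i))) →
             (toℕ (extend u X (row i) j) ℕ.< n → toℕ j ℕ.< ν u i) × (toℕ j ℕ.< ν u i → toℕ (extend u X (row i) j) ℕ.< n)
    below⇔ i j = byColumn (toℕ j ℕ.<? ν u (F.fromℕ< (toℕ-inject₁<n i)))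
      where
      i<n = toℕ-inject₁<n i
      byColumn : Dec (toℕ j ℕ.< ν u (F.fromℕ< i<n)) →
                 (toℕ (extend u X (row i) j) ℕ.< n → toℕ j ℕ.< ν u i) × (toℕ j ℕ.< ν u i → toℕ (extend u X (row i) j) ℕ.< n)
      byColumn (yes j<ν) = (λ _ → subst (λ w → toℕ j ℕ.< ν u w) (fromℕ<-inject₁ i) j<ν) ,
                           (λ _ → subst (ℕ._< n) (sym (trans (cong toℕ (extend-inside u X (row i) j i<n j<ν)) (FP.toℕ-inject₁ _))) (FP.toℕ<n _))
      byColumn (no j≮ν)  = (λ top<n → ⊥-elim (NP.<-irrefl refl (subst (ℕ._< n) (trans (cong toℕ (extend-outside u X (row i) j i<n j≮ν)) toℕ-top) top<n))) ,
                           (λ j<ν → ⊥-elim (j≮ν (subst (λ w → toℕ j ℕ.< ν u w) (sym (fromℕ<-inject₁ i)) j<ν)))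
    count≡ν : ∀ i → count i ≡ ν u i
    count≡ν i = countBelow-unique n (μ (row i)) (extend u X (row i)) (ν u i) (ν≤μ u i) (below⇔ i)
    shape≡u : shape ≡ u
    shape≡u = coord-injective shape u λ i → trans (coord-tabulateBox (gaps μ) _ i) (FP.toℕ-injective (begin
      toℕ (F.fromℕ< _)                            ≡⟨ FP.toℕ-fromℕ< _ ⟩
      count i ℕ.∸ μ (F.suc i)                      ≡⟨ cong (ℕ._∸ μ (F.suc i)) (count≡ν i) ⟩
      (μ (F.suc i) ℕ.+ point u i) ℕ.∸ μ (F.suc i)  ≡⟨ NP.m+n∸m≡n (μ (F.suc i)) _ ⟩
      point u i                                    ∎))
      where open ≡-Reasoning
    entries : ∀ i (j₁ : Fin (ν shape i)) (j₂ : Fin (ν u i)) → toℕ j₁ ≡ toℕ j₂ → restricted i j₁ ≡ X i j₂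
    entries i j₁ j₂ j₁≡j₂ = FP.toℕ-injective (begin
      toℕ (restricted i j₁)                            ≡⟨ toℕ-restricted i j₁ ⟩
      toℕ (extend u X (row i) (column i j₁))           ≡⟨ cong toℕ (extend-inside u X (row i) (column i j₁) i<n j<ν) ⟩
      toℕ (F.inject₁ (X (F.fromℕ< i<n) (F.fromℕ< j<ν))) ≡⟨ FP.toℕ-inject₁ _ ⟩
      toℕ (X (F.fromℕ< i<n) (F.fromℕ< j<ν))            ≡⟨ cong toℕ (filling-cong X (F.fromℕ< j<ν) j₂ (fromℕ<-inject₁ i)
                                                           (trans (FP.toℕ-fromℕ< j<ν) (trans (toℕ-column i j₁) j₁≡j₂))) ⟩
      toℕ (X i j₂)                                     ∎)
      where
      open ≡-Reasoning
      i<n = toℕ-inject₁<n i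
      j<ν : toℕ (column i j₁) ℕ.< ν u (F.fromℕ< i<n)
      j<ν = subst₂ ℕ._<_ (sym (trans (toℕ-column i j₁) j₁≡j₂)) (cong (ν u) (sym (fromℕ<-inject₁ i))) (FP.toℕ<n j₂)

  forward-resp : ∀ {T T′} → T ≈SST T′ → forward T ≈Σ forward T′
  forward-resp {T , T-sst} {T′ , T′-sst} T≈T′ =
    shape≡ , subst-≈SST shape≡ (Fw.restricted , Fw.restricted-sst) (Fw′.restricted , Fw′.restricted-sst) entries
    where
    module Fw  = Forward T T-sst
    module Fw′ = Forward T′ T′-sst
    shape≡ : Fw.shape ≡ Fw′.shape
    shape≡ = coord-injective Fw.shape Fw′.shape λ i → trans (coord-tabulateBox (gaps μ) _ i)
      (trans (FP.toℕ-injective (trans (FP.toℕ-fromℕ< _) (trans (cong (ℕ._∸ μ (F.suc i)) (countBelow-cong n _ _ _ (T≈T′ (F.inject₁ i))))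
                                                                 (sym (FP.toℕ-fromℕ< _)))))
             (sym (coord-tabulateBox (gaps μ) _ i)))
    entries : ∀ i (j₁ : Fin (ν Fw.shape i)) (j₂ : Fin (ν Fw′.shape i)) → toℕ j₁ ≡ toℕ j₂ → Fw.restricted i j₁ ≡ Fw′.restricted i j₂
    entries i j₁ j₂ j₁≡j₂ = FP.toℕ-injective (trans (Fw.toℕ-restricted i j₁) (trans (cong toℕ (T≈T′ _ _))
      (trans (cong toℕ (cong (T′ (F.inject₁ i)) (FP.toℕ-injective (trans (Fw.toℕ-column i j₁) (trans j₁≡j₂ (sym (Fw′.toℕ-column i j₂)))))))
             (sym (Fw′.toℕ-restricted i j₂)))))

  backward-resp : ∀ {x y} → x ≈Σ y → backward x ≈SST backward y
  backward-resp {u , X , _} {.u , Y , _} (refl , X≈Y) i j = byRow (toℕ i ℕ.<? n)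
    where
    byRow : Dec (toℕ i ℕ.< n) → extend u X i j ≡ extend u Y i j
    byRow (no i≮n)  = trans (extend-last u X i j i≮n) (sym (extend-last u Y i j i≮n))
    byRow (yes i<n) = byColumn (toℕ j ℕ.<? ν u (F.fromℕ< i<n))
      where
      byColumn : Dec (toℕ j ℕ.< ν u (F.fromℕ< i<n)) → extend u X i j ≡ extend u Y i j
      byColumn (yes j<ν) = trans (extend-inside u X i j i<n j<ν) (trans (cong F.inject₁ (X≈Y _ _)) (sym (extend-inside u Y i j i<n j<ν)))
      byColumn (no j≮ν)  = trans (extend-outside u X i j i<n j≮ν) (sym (extend-outside u Y i j i<n j≮ν))

  HasCardSST-branching : ∀ c → (∀ u → HasCardSST n (ν u) (c u)) → HasCardSST (suc n) μ (∑Boxℕ (gaps μ) c)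
  HasCardSST-branching c cards =
    HasCard-transfer (ΣRel-isEquivalence Restricted (λ _ → _≈SST_) (λ _ → ≈SST-isEquivalence)) ≈SST-isEquivalence
                     backward forward (λ {x} {y} → backward-resp {x} {y}) (λ {T} {T′} → forward-resp {T} {T′})
                     forward-backward backward-forward
                     (HasCard-ΣBox (gaps μ) Restricted (λ _ → _≈SST_) (λ _ → ≈SST-isEquivalence) c cards)

sstCount : (n : ℕ) → (Fin n → ℕ) → ℕ
sstCount zero    μ = 1
sstCount (suc n) μ = ∑Boxℕ (gaps μ) (λ u → sstCount n (interlacing μ u))

HasCardSST-sstCount : ∀ n μ → IsPartition n μ → HasCardSST n μ (sstCount n μ)
HasCardSST-sstCount zero    μ _           = (λ _ → (λ ()) , (λ ()) , (λ ())) , (λ T → F.zero , (λ ())) , (λ { F.zero F.zero _ → refl })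
HasCardSST-sstCount (suc n) μ μ-partition = HasCardSST-branching (λ u → sstCount n (interlacing μ u))
  (λ u → HasCardSST-sstCount n (interlacing μ u) (ν-partition u))
  where open Branching n μ μ-partition

shiftedParts-gaps : ∀ n (μ : Fin (suc n) → ℕ) → IsPartition (suc n) μ → ∀ i →
                    suc (shiftedParts (suc n) μ (F.suc i) ℕ.+ gaps μ i) ≡ shiftedParts (suc n) μ (F.inject₁ i)
shiftedParts-gaps n μ μ-partition i = begin
  suc ((μ (F.suc i) ℕ.+ r) ℕ.+ gaps μ i)    ≡⟨ cong suc (NP.+-assoc (μ (F.suc i)) r _) ⟩
  suc (μ (F.suc i) ℕ.+ (r ℕ.+ gaps μ i))    ≡⟨ cong (λ m → suc (μ (F.suc i) ℕ.+ m)) (NP.+-comm r _) ⟩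
  suc (μ (F.suc i) ℕ.+ (gaps μ i ℕ.+ r))    ≡⟨ cong suc (NP.+-assoc (μ (F.suc i)) _ r) ⟨
  suc ((μ (F.suc i) ℕ.+ gaps μ i) ℕ.+ r)    ≡⟨ cong (λ m → suc (m ℕ.+ r)) (NP.m+[n∸m]≡n (μ-suc≤μ-inject₁ i)) ⟩
  suc (μ (F.inject₁ i) ℕ.+ r)               ≡⟨ NP.+-suc (μ (F.inject₁ i)) r ⟨
  μ (F.inject₁ i) ℕ.+ suc r                 ≡⟨ cong (μ (F.inject₁ i) ℕ.+_) (trans (cong (n ℕ.∸_) (FP.toℕ-inject₁ i)) (NP.+-∸-assoc 1 (FP.toℕ<n i))) ⟨
  μ (F.inject₁ i) ℕ.+ (n ℕ.∸ toℕ (F.inject₁ i)) ∎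
  where
  open ≡-Reasoning
  open Branching n μ μ-partition using (μ-suc≤μ-inject₁)
  r = n ℕ.∸ suc (toℕ i)

sstCount≡binomDet : ∀ n μ → IsPartition n μ → fromℕℚ (sstCount n μ) ≡ σ n * binomDet n (shiftedParts n μ)
sstCount≡binomDet zero    μ _           = refl
sstCount≡binomDet (suc n) μ μ-partition = begin
  fromℕℚ (∑Boxℕ (gaps μ) (λ u → sstCount n (interlacing μ u)))
    ≡⟨ fromℕℚ-∑Boxℕ (gaps μ) _ ⟩
  ∑Box (gaps μ) (λ u → fromℕℚ (sstCount n (interlacing μ u)))
    ≡⟨ ∑Box-cong (gaps μ) (λ u → trans (sstCount≡binomDet n (interlacing μ u) (ν-partition u)) (cong (σ n *_) (binomDet-cong n (reassoc u)))) ⟩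
  ∑Box (gaps μ) (λ u → σ n * binomDet n (λ i → x (F.suc i) ℕ.+ point u i))
    ≡⟨ ∑Box-*ˡ (gaps μ) (σ n) _ ⟨
  σ n * B
    ≡⟨ trans (solve 3 (λ s t b → (s :* t) :* (s :* b) := (s :* s) :* (t :* b)) refl (sign n) (σ n) B)
             (trans (cong (_* (σ n * B)) (sign²≡1 n)) (QP.*-identityˡ (σ n * B))) ⟨
  σ (suc n) * (sign n * B)
    ≡⟨ cong (σ (suc n) *_) (binomDet-branching n x (gaps μ) (shiftedParts-gaps n μ μ-partition)) ⟨
  σ (suc n) * binomDet (suc n) x ∎
  where
  open ≡-Reasoning
  open Branching n μ μ-partition using (ν-partition)
  x = shiftedParts (suc n) μ
  B = ∑Box (gaps μ) (λ u → binomDet n (λ i → x (F.suc i) ℕ.+ point u i))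
  reassoc : ∀ u i → shiftedParts n (interlacing μ u) i ≡ x (F.suc i) ℕ.+ point u i
  reassoc u i = trans (NP.+-assoc (μ (F.suc i)) _ _) (trans (cong (μ (F.suc i) ℕ.+_) (NP.+-comm (point u i) _)) (sym (NP.+-assoc (μ (F.suc i)) _ _)))

theorem3p12 : (n : ℕ) → 1 ≤ n → (μ : Fin n → ℕ) → IsPartition n μ →
    Σ ℕ (λ c → HasCardSST n μ c
    × HolmanSumsTo n (Aμ n μ) (aSeq n) (ones n) (ones n) (1ℚ ÷' fromℕℚ c))
theorem3p12 n _ μ μ-partition =
  sstCount n μ ,
  HasCardSST-sstCount n μ μ-partition ,
  (n , HolmanEvaluation.holmanPartial≡1÷'count n μ μ-partition (sstCount n μ) (sstCount≡binomDet n μ μ-partition))
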